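{- Let $\lambda$ be a partition of $n$, let $\alpha=\mathrm{core}_2(\lambda)$ and $(\mu^0,\mu^1)=\mathrm{quo}_2(\lambda)$, and set $a=|\alpha|$, $m_0=|\mu^0|$, $m_1=|\mu^1|$ (so $n=a+2m_0+2m_1$). Then $f_\lambda$ is odd if and only if all of the following hold: $a\le1$ (so $\alpha$ is $\emptyset$ or $(1)$); the sets of place values at which the digit $1$ appears in the binary expansions of $a$, $2m_0$ and $2m_1$ are pairwise disjoint; and $f_{\mu^0}$ and $f_{\mu^1}$ are both odd.
   Context: For a partition $\lambda$, $f_\lambda$ is the number of standard Young tableaux of shape $\lambda$. $\mathrm{core}_2(\lambda)$ is the $2$-core of $\lambda$ (obtained by repeatedly removing dominoes that are rim hooks of length $2$ until none remain), and $\mathrm{quo}_2(\lambda)=(\mu^0,\mu^1)$ is the standard $2$-quotient of $\lambda$ (as in James–Kerber, e.g. via the $2$-abacus), a pair of partitions with $|\lambda|=|\mathrm{core}_2(\lambda)|+2(|\mu^0|+|\mu^1|)$. -}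

module Defs where

open import Data.Nat using (ℕ; zero; suc; _+_; _*_; _∸_; _^_; _<_; _≤_; _<ᵇ_; _≡ᵇ_)
open import Data.Nat.DivMod using (_/_; _%_)
open import Data.Bool using (Bool; true; false; if_then_else_; _∧_; _∨_)
open import Data.List using (List; []; _∷_; map; length; filter; filterᵇ)
open import Data.Nat.ListAction using (sum)
open import Data.List.Relation.Unary.All using (All)
open import Data.List.Relation.Unary.Linked using (Linked)
open import Data.Product using (_×_)
open import Relation.Binary.PropositionalEquality using (_≡_)
open import Relation.Nullary using (¬_)
open import Relation.Nullary.Decidable using (does)
open import Data.Nat.Properties using (_≟_)

IsPartition : List ℕ → Set
IsPartition λ′ = Linked (λ a b → b ≤ a) λ′ × All (λ a → 0 < a) λ′

size : List ℕ → ℕ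
size = sum

-- A standard Young tableau of shape λ ⊢ n is determined by the cell
-- containing n (a removable corner) together with a standard Young
-- tableau of the remaining shape; so f_∅ = 1 and
-- f_λ = Σ_{corners c} f_{λ∖c}.

private
  consPos : ℕ → List ℕ → List ℕ
  consPos zero xs = xs
  consPos (suc k) xs = suc k ∷ xs

removeCorners : List ℕ → List (List ℕ)
removeCorners [] = []
removeCorners (x ∷ []) = consPos (x ∸ 1) [] ∷ []
removeCorners (x ∷ y ∷ ys) =
  let rest = map (x ∷_) (removeCorners (y ∷ ys)) in
  if y <ᵇ x then ((x ∸ 1) ∷ y ∷ ys) ∷ rest else rest

-- fuel-driven recursion (fuel = |λ| suffices: each step removes a box)
sytFuel : ℕ → List ℕ → ℕ
sytFuel zero _ = 1
sytFuel (suc k) [] = 1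
sytFuel (suc k) (x ∷ xs) = sum (map (sytFuel k) (removeCorners (x ∷ xs)))

f : List ℕ → ℕ
f λ′ = sytFuel (size λ′) λ′

-- convert a strictly decreasing β-set b₁ > … > b_s into the partition
-- (b_i − (s − i))_i, dropping zero parts
betaToPartition : List ℕ → List ℕ
betaToPartition bs = go (length bs) bs
  where
  go : ℕ → List ℕ → List ℕ
  go s [] = []
  go s (b ∷ rest) = consPos (b ∸ (s ∸ 1)) (go (s ∸ 1) rest)

-- number of β-numbers used: length of λ rounded up to an even number
-- (a multiple of 2, as in James–Kerber)
beadCount : List ℕ → ℕ
beadCount λ′ = length λ′ + (length λ′ % 2)

-- β-set {λ_i + r − i : 1 ≤ i ≤ r} with r = beadCount λ, listed decreasingly
betaSet : List ℕ → List ℕ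
betaSet λ′ = go (beadCount λ′) λ′
  where
  go : ℕ → List ℕ → List ℕ
  go zero _ = []
  go (suc r) [] = r ∷ go r []
  go (suc r) (x ∷ xs) = (x + r) ∷ go r xs

-- positions of beads on runner j (j ∈ {0,1}): β = 2k + j  ↦  k
runner : ℕ → List ℕ → List ℕ
runner j bs = map (λ b → b / 2) (filter (λ b → (b % 2) ≟ j) bs)

quo0 quo1 : List ℕ → List ℕ
quo0 λ′ = betaToPartition (runner 0 (betaSet λ′))
quo1 λ′ = betaToPartition (runner 1 (betaSet λ′))

-- 2-core: push all beads on each runner to the top
-- (runner j with c_j beads ↦ β-numbers {2k + j : k < c_j})
private
  downFrom : ℕ → List ℕ
  downFrom zero = []
  downFrom (suc n) = n ∷ downFrom n

core2 : List ℕ → List ℕ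
core2 λ′ =
  let bs = betaSet λ′
      c0 = length (runner 0 bs)
      c1 = length (runner 1 bs)
      keep : ℕ → Bool
      keep x = if does ((x % 2) ≟ 0) then (x / 2) <ᵇ c0 else (x / 2) <ᵇ c1
  in betaToPartition (filterᵇ keep (downFrom (2 * (c0 + c1) + 2)))

bit : ℕ → ℕ → ℕ
bit zero n = n % 2
bit (suc k) n = bit k (n / 2)

BinDisjoint : ℕ → ℕ → Set
BinDisjoint a b = ∀ k → ¬ (bit k a ≡ 1 × bit k b ≡ 1)

Odd : ℕ → Set
Odd n = n % 2 ≡ 1

{-# OPTIONS --safe #-}
-- An abacus word (beads and gaps, read from the top) encodes a partition, and
-- removing a corner is sliding a bead one place down into a gap.  Applying the
-- branching rule f λ = Σ f (λ − corner) twice and reducing modulo 2, pairs of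
-- slides of different beads cancel, so f λ ≡ Σ f (λ − domino) (mod 2) once
-- |λ| ≥ 2.  On the 2-abacus a domino is a slide on one runner, so induction on
-- |μ⁰| + |μ¹| gives
--   f λ ≡ [|core₂ λ| ≤ 1] · binomial (|μ⁰| + |μ¹|) |μ⁰| · f μ⁰ · f μ¹  (mod 2),
-- the base case being a 2-core: it has no dominoes, so f is even unless it has
-- at most one box.  By Lucas' theorem the binomial coefficient is odd exactly
-- when |μ⁰| and |μ¹| have disjoint binary digits.
module Submission where

open import Defs
open import Data.Nat using (ℕ; _≤_; _*_)
open import Data.List using (List)
open import Data.Product using (_×_)
open import Function.Bundles using (_⇔_)

open import Data.Nat as ℕ using (zero; suc; _+_; _∸_; _<_; _<ᵇ_; _≤ᵇ_; z≤n; s≤s; ⌊_/2⌋)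
open import Data.Nat.Properties as ℕ using ()
open import Data.Nat.DivMod using (_/_; _%_; m/n≡1+[m∸n]/n)
open import Data.Nat.ListAction using (sum)
open import Data.Bool using (Bool; true; false; not; _∧_; _xor_; if_then_else_)
open import Data.Bool.Properties as Bool using ()
open import Data.List as List using ([]; _∷_; length; map)
open import Data.List.Properties using (map-∘)
open import Data.List.Relation.Unary.All as All using (All; []; _∷_)
open import Data.List.Relation.Unary.Linked using (Linked; [-]; _∷_)
open import Data.Product using (_,_; proj₁; proj₂)
open import Data.Empty using (⊥-elim)
open import Data.Sum using (inj₁; inj₂)
open import Data.Maybe using (just)
open import Relation.Nullary using (¬_; yes; no)
open import Relation.Nullary.Decidable using (does)
open import Relation.Binary.PropositionalEquality
open import Function.Base using (_∘_)
open import Function.Bundles using (mk⇔; Equivalence)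
open import Function.Construct.Composition using () renaming (equivalence to ⇔-trans)
open import Function.Construct.Symmetry using (⇔-sym)
open import Function.Construct.Identity using (⇔-id)
open import Data.Product.Function.NonDependent.Propositional using (_×-⇔_)
open import Algebra.Structures using (IsCommutativeMonoid)
open import Algebra.Bundles using (CommutativeRing; CommutativeSemigroup)
open import Level using (0ℓ)
import Algebra.Properties.CommutativeSemigroup as CommutativeSemigroupProperties
open import Data.Unit using (⊤; tt)
open import Data.Fin using (#_)
open import Data.Vec using ([]; _∷_)
import Algebra.Solver.CommutativeMonoid as CommutativeMonoidSolver

-- β-numbers, 2-quotients and 2-cores

prepend : ℕ → List ℕ → List ℕ
prepend zero xs = xs
prepend (suc k) xs = suc k ∷ xs

betaList : ℕ → List ℕ → List ℕ
betaList zero _ = []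
betaList (suc r) [] = r ∷ betaList r []
betaList (suc r) (x ∷ xs) = (x + r) ∷ betaList r xs

isCoreBead : ℕ → ℕ → ℕ → Bool
isCoreBead c₀ c₁ x = if does ((x % 2) ℕ.≟ 0) then (x / 2) <ᵇ c₀ else (x / 2) <ᵇ c₁

addIf : Bool → ℕ → List ℕ → List ℕ
addIf x b bs = if x then b ∷ bs else bs

-- The β-numbers below n of the 2-abacus whose runners 0 and 1 carry c₀ and c₁
-- beads in their lowest positions.
coreBeta : ℕ → ℕ → ℕ → List ℕ
coreBeta c₀ c₁ zero = []
coreBeta c₀ c₁ (suc n) = addIf (isCoreBead c₀ c₁ n) n (coreBeta c₀ c₁ n)

-- Local and private functions of Defs cannot be named from outside.  Each
-- metavariable below is solved by unification with one of them (the withs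
-- turn its arguments into variables), and then shown to agree with its
-- public counterpart above.
module Unfolding where
  mutual
    betaSetGo : List ℕ → ℕ → List ℕ → List ℕ
    betaSetGo = _

    betaToPartitionGo : List ℕ → ℕ → List ℕ → List ℕ
    betaToPartitionGo = _

    private
      solve-betaSetGo : ∀ x xs → List.tail (betaSet (x ∷ xs)) ≡ List.tail (betaSet (x ∷ xs))
      solve-betaSetGo x xs with x ∷ xs
      ... | l with length xs + suc (length xs) % 2
      ... | r = cong just (refl {x = betaSetGo l r xs})

      solve-betaToPartitionGo : ∀ b bs → betaToPartition (b ∷ bs) ≡ betaToPartition (b ∷ bs)
      solve-betaToPartitionGo b bs with b ∷ bs
      ... | l with length bs
      ... | s with b ∸ s
      ... | zero = refl {x = betaToPartitionGo l s bs}
      ... | suc _ = refl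

  mutual
    consPos : ℕ → List ℕ → List ℕ
    consPos = _

    private
      solve-consPos : ∀ b bs → betaToPartition (b ∷ bs) ≡ betaToPartition (b ∷ bs)
      solve-consPos b bs with b ∷ bs
      ... | l with length bs
      ... | s with b ∸ s
      ... | k with betaToPartitionGo l s bs
      ... | xs = refl {x = consPos k xs}

  mutual
    filteredDownFrom : ℕ → ℕ → ℕ → List ℕ
    filteredDownFrom = _

    private
      solve-filteredDownFrom : ∀ l → core2 l ≡ core2 l
      solve-filteredDownFrom l with betaSet l
      ... | bs with length (runner 0 bs)
      ... | c₀ with length (runner 1 bs)
      ... | c₁ with 2 * (c₀ + c₁) + 2
      ... | n with betaToPartitionGo
      ... | go = refl {x = go (filteredDownFrom c₀ c₁ n) _ _}

  betaSetGo≡betaList : ∀ l r xs → betaSetGo l r xs ≡ betaList r xs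
  betaSetGo≡betaList l zero xs = refl
  betaSetGo≡betaList l (suc r) [] = cong (r ∷_) (betaSetGo≡betaList l r [])
  betaSetGo≡betaList l (suc r) (x ∷ xs) = cong (x + r ∷_) (betaSetGo≡betaList l r xs)

  consPos≡prepend : ∀ k xs → consPos k xs ≡ prepend k xs
  consPos≡prepend zero xs = refl
  consPos≡prepend (suc k) xs = refl

  betaToPartitionGo-irrelevant : ∀ l l′ bs → betaToPartitionGo l (length bs) bs ≡ betaToPartitionGo l′ (length bs) bs
  betaToPartitionGo-irrelevant l l′ [] = refl
  betaToPartitionGo-irrelevant l l′ (b ∷ bs) = cong (consPos (b ∸ length bs)) (betaToPartitionGo-irrelevant l l′ bs)

  filteredDownFrom≡coreBeta : ∀ c₀ c₁ n → filteredDownFrom c₀ c₁ n ≡ coreBeta c₀ c₁ n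
  filteredDownFrom≡coreBeta c₀ c₁ zero = refl
  filteredDownFrom≡coreBeta c₀ c₁ (suc n) with isCoreBead c₀ c₁ n
  ... | true = cong (n ∷_) (filteredDownFrom≡coreBeta c₀ c₁ n)
  ... | false = filteredDownFrom≡coreBeta c₀ c₁ n

betaSet≡betaList : ∀ l → betaSet l ≡ betaList (beadCount l) l
betaSet≡betaList l = Unfolding.betaSetGo≡betaList l (beadCount l) l

betaToPartition-∷ : ∀ b bs → betaToPartition (b ∷ bs) ≡ prepend (b ∸ length bs) (betaToPartition bs)
betaToPartition-∷ b bs = trans (cong (consPos (b ∸ length bs)) (betaToPartitionGo-irrelevant (b ∷ bs) bs bs))
                               (consPos≡prepend (b ∸ length bs) (betaToPartition bs))
  where open Unfolding

core2≡coreBeta : ∀ l → let c₀ = length (runner 0 (betaSet l)); c₁ = length (runner 1 (betaSet l)) in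
                 core2 l ≡ betaToPartition (coreBeta c₀ c₁ (2 * (c₀ + c₁) + 2))
core2≡coreBeta l = cong betaToPartition (Unfolding.filteredDownFrom≡coreBeta c₀ c₁ (2 * (c₀ + c₁) + 2))
  where
  c₀ c₁ : ℕ
  c₀ = length (runner 0 (betaSet l))
  c₁ = length (runner 1 (betaSet l))

-- Parity and binary digits

isOdd : ℕ → Bool
isOdd zero = false
isOdd (suc n) = not (isOdd n)

isOdd-+ : ∀ m n → isOdd (m + n) ≡ isOdd m xor isOdd n
isOdd-+ zero n = refl
isOdd-+ (suc m) n = trans (cong not (isOdd-+ m n)) (Bool.not-distribˡ-xor (isOdd m) (isOdd n))

n%2≡isOdd : ∀ n → n % 2 ≡ (if isOdd n then 1 else 0)
n%2≡isOdd zero = refl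
n%2≡isOdd (suc zero) = refl
n%2≡isOdd (suc (suc n)) = trans (n%2≡isOdd n) (cong (if_then 1 else 0) (sym (Bool.not-involutive (isOdd n))))

Odd⇒isOdd : ∀ n → Odd n → isOdd n ≡ true
Odd⇒isOdd n odd with isOdd n | n%2≡isOdd n
... | true | _ = refl
... | false | n%2≡0 = ⊥-elim (ℕ.1+n≢0 (trans (sym odd) n%2≡0))

isOdd⇒Odd : ∀ n → isOdd n ≡ true → Odd n
isOdd⇒Odd n odd = trans (n%2≡isOdd n) (cong (if_then 1 else 0) odd)

Odd⇔isOdd : ∀ n → Odd n ⇔ (isOdd n ≡ true)
Odd⇔isOdd n = mk⇔ (Odd⇒isOdd n) (isOdd⇒Odd n)

double : ℕ → ℕ
double zero = zero
double (suc k) = suc (suc (double k))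

toDigit : Bool → ℕ
toDigit false = 0
toDigit true = 1

toDigit-+-suc² : ∀ i x → toDigit i + suc (suc x) ≡ suc (suc (toDigit i + x))
toDigit-+-suc² false x = refl
toDigit-+-suc² true x = refl

isOdd-double : ∀ k → isOdd (double k) ≡ false
isOdd-double zero = refl
isOdd-double (suc k) = trans (Bool.not-involutive (isOdd (double k))) (isOdd-double k)

isOdd-toDigit+double : ∀ i k → isOdd (toDigit i + double k) ≡ i
isOdd-toDigit+double false k = isOdd-double k
isOdd-toDigit+double true k = cong not (isOdd-double k)

n≡toDigit+double : ∀ n → n ≡ toDigit (isOdd n) + double ⌊ n /2⌋
n≡toDigit+double zero = refl
n≡toDigit+double (suc zero) = refl
n≡toDigit+double (suc (suc n)) = sym (begin
  toDigit (not (not (isOdd n))) + double (suc ⌊ n /2⌋)   ≡⟨ toDigit-+-suc² (not (not (isOdd n))) (double ⌊ n /2⌋) ⟩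
  suc (suc (toDigit (not (not (isOdd n))) + double ⌊ n /2⌋)) ≡⟨ cong (λ b → suc (suc (toDigit b + double ⌊ n /2⌋))) (Bool.not-involutive (isOdd n)) ⟩
  suc (suc (toDigit (isOdd n) + double ⌊ n /2⌋))           ≡⟨ cong (suc ∘ suc) (n≡toDigit+double n) ⟨
  suc (suc n)                                              ∎)
  where open ≡-Reasoning

n/2≡⌊n/2⌋ : ∀ n → n / 2 ≡ ⌊ n /2⌋
n/2≡⌊n/2⌋ zero = refl
n/2≡⌊n/2⌋ (suc zero) = refl
n/2≡⌊n/2⌋ (suc (suc n)) = trans (m/n≡1+[m∸n]/n {suc (suc n)} {2} (s≤s (s≤s z≤n))) (cong suc (n/2≡⌊n/2⌋ n))

double%2 : ∀ k → double k % 2 ≡ 0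
double%2 zero = refl
double%2 (suc k) = double%2 k

1+double%2 : ∀ k → suc (double k) % 2 ≡ 1
1+double%2 zero = refl
1+double%2 (suc k) = 1+double%2 k

double/2 : ∀ k → double k / 2 ≡ k
double/2 k = trans (n/2≡⌊n/2⌋ (double k)) (halve k)
  where
  halve : ∀ k → ⌊ double k /2⌋ ≡ k
  halve zero = refl
  halve (suc k) = cong suc (halve k)

1+double/2 : ∀ k → suc (double k) / 2 ≡ k
1+double/2 k = trans (n/2≡⌊n/2⌋ (suc (double k))) (halve k)
  where
  halve : ∀ k → ⌊ suc (double k) /2⌋ ≡ k
  halve zero = refl
  halve (suc k) = cong suc (halve k)

double≡2* : ∀ m → double m ≡ 2 * m
double≡2* zero = refl
double≡2* (suc m) = cong suc (trans (cong suc (double≡2* m)) (sym (ℕ.+-suc m (m + 0))))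

n≤double : ∀ k → k ≤ double k
n≤double zero = z≤n
n≤double (suc k) = s≤s (ℕ.m≤n⇒m≤1+n (n≤double k))

-- Abacus words and bead slides

-- An abacus word lists the positions of an abacus from the highest down,
-- true marking a bead; a bead with g gaps below it is a part g of its shape.
Word : Set
Word = List Bool

gaps : Word → ℕ
gaps [] = 0
gaps (false ∷ w) = suc (gaps w)
gaps (true ∷ w) = gaps w

beads : Word → ℕ
beads [] = 0
beads (false ∷ w) = beads w
beads (true ∷ w) = suc (beads w)

shape : Word → List ℕ
shape [] = []
shape (false ∷ w) = shape w
shape (true ∷ w) = prepend (gaps w) (shape w)

weight : Word → ℕ
weight w = size (shape w)

size-prepend : ∀ k xs → size (prepend k xs) ≡ k + size xs
size-prepend zero xs = refl
size-prepend (suc k) xs = refl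

weight-bead : ∀ w → weight (true ∷ w) ≡ gaps w + weight w
weight-bead w = size-prepend (gaps w) (shape w)

gaps+beads≡length : ∀ w → gaps w + beads w ≡ length w
gaps+beads≡length [] = refl
gaps+beads≡length (false ∷ w) = cong suc (gaps+beads≡length w)
gaps+beads≡length (true ∷ w) = trans (ℕ.+-suc (gaps w) (beads w)) (cong suc (gaps+beads≡length w))

beads≤length : ∀ w → beads w ≤ length w
beads≤length w = subst (beads w ≤_) (gaps+beads≡length w) (ℕ.m≤n+m (beads w) (gaps w))

-- Sums over the words obtained by sliding one bead one position down
-- into a gap, resp. two positions down across any letter.
module SlideSums {a} {A : Set a} (_∙_ : A → A → A) (ε : A) where

  slideSum : (Word → A) → Word → A
  slideSum F [] = ε
  slideSum F (true ∷ false ∷ w) = F (false ∷ true ∷ w) ∙ slideSum (F ∘ (true ∷_)) (false ∷ w)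
  slideSum F (true ∷ true ∷ w) = slideSum (F ∘ (true ∷_)) (true ∷ w)
  slideSum F (true ∷ []) = ε
  slideSum F (false ∷ w) = slideSum (F ∘ (false ∷_)) w

  dominoSum : (Word → A) → Word → A
  dominoSum F [] = ε
  dominoSum F (true ∷ y ∷ false ∷ w) = F (false ∷ y ∷ true ∷ w) ∙ dominoSum (F ∘ (true ∷_)) (y ∷ false ∷ w)
  dominoSum F (true ∷ y ∷ true ∷ w) = dominoSum (F ∘ (true ∷_)) (y ∷ true ∷ w)
  dominoSum F (true ∷ y ∷ []) = ε
  dominoSum F (true ∷ []) = ε
  dominoSum F (false ∷ w) = dominoSum (F ∘ (false ∷_)) w

AllSlides : (Word → Set) → Word → Set
AllSlides = SlideSums.slideSum _×_ ⊤

allSlides-map : ∀ {Q R : Word → Set} → (∀ t → Q t → R t) → ∀ w → AllSlides Q w → AllSlides R w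
allSlides-map f [] _ = tt
allSlides-map f (true ∷ false ∷ w) (q , qs) = f _ q , allSlides-map (f ∘ (true ∷_)) (false ∷ w) qs
allSlides-map f (true ∷ true ∷ w) qs = allSlides-map (f ∘ (true ∷_)) (true ∷ w) qs
allSlides-map f (true ∷ []) _ = tt
allSlides-map f (false ∷ w) qs = allSlides-map (f ∘ (false ∷_)) w qs

allSlides-universal : ∀ {Q : Word → Set} → (∀ t → Q t) → ∀ w → AllSlides Q w
allSlides-universal f [] = tt
allSlides-universal f (true ∷ false ∷ w) = f _ , allSlides-universal (f ∘ (true ∷_)) (false ∷ w)
allSlides-universal f (true ∷ true ∷ w) = allSlides-universal (f ∘ (true ∷_)) (true ∷ w)
allSlides-universal f (true ∷ []) = tt
allSlides-universal f (false ∷ w) = allSlides-universal (f ∘ (false ∷_)) w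

interleave : Word → Word → Word
interleave [] v = v
interleave (a ∷ u) v = a ∷ interleave v u

data Balanced : Word → Word → Set where
  [] : Balanced [] []
  _∷_ : ∀ a {u v} → Balanced v u → Balanced (a ∷ u) v

balanced-resize : ∀ {u v u′ v′} → Balanced u v → length u′ ≡ length u → length v′ ≡ length v → Balanced u′ v′
balanced-resize {u′ = []} {[]} [] _ _ = []
balanced-resize {u′ = a ∷ u′} (_ ∷ b) u≡ v≡ = a ∷ balanced-resize b v≡ (ℕ.suc-injective u≡)

balanced-sameLength : ∀ u v → length u ≡ length v → Balanced u v
balanced-sameLength [] [] _ = []
balanced-sameLength (a ∷ u) (b ∷ v) eq = a ∷ (b ∷ balanced-sameLength u v (ℕ.suc-injective eq))

module SlideSumProperties {A : Set} {_∙_ : A → A → A} {ε : A} where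
  open SlideSums _∙_ ε

  slideSum-cong : ∀ {F G : Word → A} w → AllSlides (λ t → F t ≡ G t) w → slideSum F w ≡ slideSum G w
  slideSum-cong [] _ = refl
  slideSum-cong {F} {G} (true ∷ false ∷ w) (eq , eqs) =
    cong₂ _∙_ eq (slideSum-cong {F ∘ (true ∷_)} {G ∘ (true ∷_)} (false ∷ w) eqs)
  slideSum-cong {F} {G} (true ∷ true ∷ w) eqs = slideSum-cong {F ∘ (true ∷_)} {G ∘ (true ∷_)} (true ∷ w) eqs
  slideSum-cong (true ∷ []) _ = refl
  slideSum-cong {F} {G} (false ∷ w) eqs = slideSum-cong {F ∘ (false ∷_)} {G ∘ (false ∷_)} w eqs

  module Commutative (isCommutativeMonoid : IsCommutativeMonoid _≡_ _∙_ ε) where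
    open IsCommutativeMonoid isCommutativeMonoid using (assoc; comm; identityˡ; isCommutativeSemigroup)

    commutativeSemigroup : CommutativeSemigroup 0ℓ 0ℓ
    commutativeSemigroup = record { isCommutativeSemigroup = isCommutativeSemigroup }

    open CommutativeSemigroupProperties commutativeSemigroup using (interchange)

    slideSum-ε : ∀ w → slideSum (λ _ → ε) w ≡ ε
    slideSum-ε [] = refl
    slideSum-ε (true ∷ false ∷ w) = trans (cong (ε ∙_) (slideSum-ε (false ∷ w))) (identityˡ ε)
    slideSum-ε (true ∷ true ∷ w) = slideSum-ε (true ∷ w)
    slideSum-ε (true ∷ []) = refl
    slideSum-ε (false ∷ w) = slideSum-ε w

    slideSum-∙ : ∀ (F G : Word → A) w → slideSum (λ t → F t ∙ G t) w ≡ slideSum F w ∙ slideSum G w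
    slideSum-∙ F G [] = sym (identityˡ ε)
    slideSum-∙ F G (true ∷ false ∷ w) =
      trans (cong ((F (false ∷ true ∷ w) ∙ G (false ∷ true ∷ w)) ∙_) (slideSum-∙ (F ∘ (true ∷_)) (G ∘ (true ∷_)) (false ∷ w)))
            (interchange _ _ _ _)
    slideSum-∙ F G (true ∷ true ∷ w) = slideSum-∙ (F ∘ (true ∷_)) (G ∘ (true ∷_)) (true ∷ w)
    slideSum-∙ F G (true ∷ []) = sym (identityˡ ε)
    slideSum-∙ F G (false ∷ w) = slideSum-∙ (F ∘ (false ∷_)) (G ∘ (false ∷_)) w

    -- A domino in interleave u v is a single slide in u or in v.
    dominoSum-interleave : ∀ {u v} → Balanced u v → ∀ F →
      dominoSum F (interleave u v) ≡ slideSum (λ s → F (interleave s v)) u ∙ slideSum (F ∘ interleave u) v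
    dominoSum-interleave [] F = sym (identityˡ ε)
    dominoSum-interleave (false ∷ b) F = trans (dominoSum-interleave b (F ∘ (false ∷_))) (comm _ _)
    dominoSum-interleave {true ∷ []} (true ∷ []) F = sym (identityˡ ε)
    dominoSum-interleave {true ∷ []} (true ∷ (false ∷ [])) F = sym (identityˡ ε)
    dominoSum-interleave {true ∷ []} (true ∷ (true ∷ [])) F = sym (identityˡ ε)
    dominoSum-interleave {true ∷ false ∷ u} {y ∷ v} (true ∷ (_ ∷ b)) F =
      trans (cong (F (false ∷ y ∷ true ∷ interleave v u) ∙_)
                  (trans (dominoSum-interleave (y ∷ b) (F ∘ (true ∷_))) (comm _ _)))
            (sym (assoc _ _ _))
    dominoSum-interleave {true ∷ true ∷ u} {y ∷ v} (true ∷ (_ ∷ b)) F =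
      trans (dominoSum-interleave (y ∷ b) (F ∘ (true ∷_))) (comm _ _)

module _ {A B : Set} {_∙_ : A → A → A} {ε : A} {_◦_ : B → B → B} {ε′ : B} where
  open SlideSums

  slideSum-homomorphic : ∀ (h : A → B) → (∀ x y → h (x ∙ y) ≡ h x ◦ h y) → h ε ≡ ε′ →
                         ∀ F w → slideSum _◦_ ε′ (h ∘ F) w ≡ h (slideSum _∙_ ε F w)
  slideSum-homomorphic h h-∙ h-ε F [] = sym h-ε
  slideSum-homomorphic h h-∙ h-ε F (true ∷ false ∷ w) =
    trans (cong (h (F (false ∷ true ∷ w)) ◦_) (slideSum-homomorphic h h-∙ h-ε (F ∘ (true ∷_)) (false ∷ w)))
          (sym (h-∙ _ _))
  slideSum-homomorphic h h-∙ h-ε F (true ∷ true ∷ w) = slideSum-homomorphic h h-∙ h-ε (F ∘ (true ∷_)) (true ∷ w)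
  slideSum-homomorphic h h-∙ h-ε F (true ∷ []) = sym h-ε
  slideSum-homomorphic h h-∙ h-ε F (false ∷ w) = slideSum-homomorphic h h-∙ h-ε (F ∘ (false ∷_)) w

open SlideSums _+_ 0 using () renaming (slideSum to sumSlides; dominoSum to sumDominoes)
open SlideSums _xor_ false using () renaming (slideSum to xorSlides; dominoSum to xorDominoes)
open SlideSumProperties

xor-isCommutativeMonoid : IsCommutativeMonoid _≡_ _xor_ false
xor-isCommutativeMonoid = CommutativeRing.+-isCommutativeMonoid Bool.xor-∧-commutativeRing

module XorSlides = Commutative xor-isCommutativeMonoid
module SumSlides = Commutative ℕ.+-0-isCommutativeMonoid

record OneBoxLess (w t : Word) : Set where
  field
    length≡ : length t ≡ length w
    beads≡ : beads t ≡ beads w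
    gaps≡ : gaps t ≡ gaps w
    weight≡ : suc (weight t) ≡ weight w
open OneBoxLess

oneBoxLess-bead : ∀ {w t} → OneBoxLess w t → OneBoxLess (true ∷ w) (true ∷ t)
oneBoxLess-bead {w} {t} p = record
  { length≡ = cong suc (length≡ p)
  ; beads≡ = cong suc (beads≡ p)
  ; gaps≡ = gaps≡ p
  ; weight≡ = begin
      suc (weight (true ∷ t)) ≡⟨ cong suc (weight-bead t) ⟩
      suc (gaps t + weight t) ≡⟨ ℕ.+-suc (gaps t) (weight t) ⟨
      gaps t + suc (weight t) ≡⟨ cong₂ _+_ (gaps≡ p) (weight≡ p) ⟩
      gaps w + weight w       ≡⟨ weight-bead w ⟨
      weight (true ∷ w)       ∎
  }
  where open ≡-Reasoning

oneBoxLess-gap : ∀ {w t} → OneBoxLess w t → OneBoxLess (false ∷ w) (false ∷ t)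
oneBoxLess-gap p = record
  { length≡ = cong suc (length≡ p) ; beads≡ = beads≡ p ; gaps≡ = cong suc (gaps≡ p) ; weight≡ = weight≡ p }

slides-oneBoxLess : ∀ w → AllSlides (OneBoxLess w) w
slides-oneBoxLess [] = tt
slides-oneBoxLess (true ∷ false ∷ w) =
  record { length≡ = refl ; beads≡ = refl ; gaps≡ = refl
         ; weight≡ = trans (cong suc (weight-bead w)) (sym (weight-bead (false ∷ w))) } ,
  allSlides-map (λ t → oneBoxLess-bead {false ∷ w} {t}) (false ∷ w) (slides-oneBoxLess (false ∷ w))
slides-oneBoxLess (true ∷ true ∷ w) = allSlides-map (λ t → oneBoxLess-bead {true ∷ w} {t}) (true ∷ w) (slides-oneBoxLess (true ∷ w))
slides-oneBoxLess (true ∷ []) = tt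
slides-oneBoxLess (false ∷ w) = allSlides-map (λ t → oneBoxLess-gap {w} {t}) w (slides-oneBoxLess w)

allSlides-oneBoxLess : ∀ {Q : Word → Set} w → (∀ t → OneBoxLess w t → Q t) → AllSlides Q w
allSlides-oneBoxLess w f = allSlides-map f w (slides-oneBoxLess w)

slideSum-weight≡0 : ∀ {A : Set} {_∙_ : A → A → A} {ε : A} (F : Word → A) w →
                    weight w ≡ 0 → SlideSums.slideSum _∙_ ε F w ≡ ε
slideSum-weight≡0 F [] _ = refl
slideSum-weight≡0 F (true ∷ false ∷ w) eq = ⊥-elim (ℕ.1+n≢0 (trans (sym (weight-bead (false ∷ w))) eq))
slideSum-weight≡0 F (true ∷ true ∷ w) eq =
  slideSum-weight≡0 (F ∘ (true ∷_)) (true ∷ w) (ℕ.m+n≡0⇒n≡0 (gaps w) (trans (sym (weight-bead (true ∷ w))) eq))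
slideSum-weight≡0 F (true ∷ []) _ = refl
slideSum-weight≡0 F (false ∷ w) eq = slideSum-weight≡0 (F ∘ (false ∷_)) w eq

0<m+n⇒0<n : ∀ {m n} → m ≤ n → 0 < m + n → 0 < n
0<m+n⇒0<n {n = suc _} _ _ = s≤s z≤n
0<m+n⇒0<n {zero} {zero} _ ()

gaps≤weight-bead : ∀ w → gaps w ≤ weight (true ∷ w)
gaps≤weight-bead w = subst (gaps w ≤_) (sym (weight-bead w)) (ℕ.m≤m+n (gaps w) (weight w))

slide-exists : ∀ w → 0 < weight w → 0 < sumSlides (λ _ → 1) w
slide-exists (true ∷ false ∷ w) _ = s≤s z≤n
slide-exists (true ∷ true ∷ w) 0<weight =
  slide-exists (true ∷ w) (0<m+n⇒0<n (gaps≤weight-bead w) (subst (0 <_) (weight-bead (true ∷ w)) 0<weight))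
slide-exists (false ∷ w) 0<weight = slide-exists w 0<weight

domino⇒2≤weight : ∀ w → 0 < sumDominoes (λ _ → 1) w → 2 ≤ weight w
domino⇒2≤weight (true ∷ false ∷ false ∷ w) _ =
  subst (2 ≤_) (sym (weight-bead (false ∷ false ∷ w))) (s≤s (s≤s z≤n))
domino⇒2≤weight (true ∷ true ∷ false ∷ w) _ =
  subst (2 ≤_) (sym (trans (weight-bead (true ∷ false ∷ w)) (cong (suc (gaps w) +_) (weight-bead (false ∷ w)))))
    (ℕ.+-mono-≤ (s≤s z≤n) (s≤s z≤n))
domino⇒2≤weight (true ∷ y ∷ true ∷ w) domino =
  subst (2 ≤_) (sym (weight-bead (y ∷ true ∷ w)))
    (ℕ.≤-trans (domino⇒2≤weight (y ∷ true ∷ w) domino) (ℕ.m≤n+m _ _))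
domino⇒2≤weight (false ∷ w) domino = domino⇒2≤weight w domino

prepend-all : ∀ {P : ℕ → Set} {k xs} → P k → All P xs → All P (prepend k xs)
prepend-all {k = zero} _ ps = ps
prepend-all {k = suc k} pk ps = pk ∷ ps

shape-bounded : ∀ w → All (_≤ gaps w) (shape w)
shape-bounded [] = []
shape-bounded (false ∷ w) = All.map ℕ.m≤n⇒m≤1+n (shape-bounded w)
shape-bounded (true ∷ w) = prepend-all ℕ.≤-refl (shape-bounded w)

shape-positive : ∀ w → All (0 <_) (shape w)
shape-positive [] = []
shape-positive (false ∷ w) = shape-positive w
shape-positive (true ∷ w) = prepend-positive (gaps w) (shape-positive w)
  where
  prepend-positive : ∀ k {xs} → All (0 <_) xs → All (0 <_) (prepend k xs)
  prepend-positive zero ps = ps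
  prepend-positive (suc k) ps = s≤s z≤n ∷ ps

positive-size≡0 : ∀ {xs} → All (0 <_) xs → size xs ≡ 0 → xs ≡ []
positive-size≡0 [] _ = refl
positive-size≡0 {x ∷ _} (0<x ∷ _) eq = ⊥-elim (ℕ.<-irrefl (sym (ℕ.m+n≡0⇒m≡0 x eq)) 0<x)

positive-size≡1 : ∀ {xs} → All (0 <_) xs → size xs ≡ 1 → xs ≡ 1 ∷ []
positive-size≡1 {suc zero ∷ _} (_ ∷ ps) eq = cong (1 ∷_) (positive-size≡0 ps (ℕ.suc-injective eq))
positive-size≡1 {suc (suc _) ∷ _} _ ()

weight≡0⇒shape≡[] : ∀ w → weight w ≡ 0 → shape w ≡ []
weight≡0⇒shape≡[] w = positive-size≡0 (shape-positive w)

gaps≡0⇒shape≡[] : ∀ w → gaps w ≡ 0 → shape w ≡ []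
gaps≡0⇒shape≡[] w eq = noParts (subst (λ g → All (_≤ g) (shape w)) eq (shape-bounded w)) (shape-positive w)
  where
  noParts : ∀ {xs} → All (_≤ 0) xs → All (0 <_) xs → xs ≡ []
  noParts [] _ = refl
  noParts (x≤0 ∷ _) (0<x ∷ _) = ⊥-elim (ℕ.<-irrefl refl (ℕ.<-≤-trans 0<x x≤0))

-- The branching rule on abacus words

<ᵇ-true : ∀ {m n} → m < n → (m <ᵇ n) ≡ true
<ᵇ-true {zero} (s≤s _) = refl
<ᵇ-true {suc m} (s≤s m<n) = <ᵇ-true m<n

<ᵇ-false : ∀ {m n} → n ≤ m → (m <ᵇ n) ≡ false
<ᵇ-false z≤n = refl
<ᵇ-false (s≤s n≤m) = <ᵇ-false n≤m

removeCorners-longest : ∀ x {xs} → All (_< x) xs → All (0 <_) xs →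
                        removeCorners (x ∷ xs) ≡ prepend (x ∸ 1) xs ∷ map (x ∷_) (removeCorners xs)
removeCorners-longest x [] [] = cong (_∷ []) (Unfolding.consPos≡prepend (x ∸ 1) [])
removeCorners-longest (suc (suc x)) {y ∷ _} (y<x ∷ _) _ rewrite <ᵇ-true y<x = refl
removeCorners-longest (suc zero) (s≤s () ∷ _) (s≤s _ ∷ _)

removeCorners-repeated : ∀ x xs → removeCorners (x ∷ x ∷ xs) ≡ map (x ∷_) (removeCorners (x ∷ xs))
removeCorners-repeated x xs rewrite <ᵇ-false (ℕ.≤-refl {x}) = refl

sum-map-∘ : ∀ {A B : Set} (g : B → ℕ) (h : A → B) xs → sum (map g (map h xs)) ≡ sum (map (g ∘ h) xs)
sum-map-∘ g h xs = cong sum (sym (map-∘ xs))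

removeCorners-shape : ∀ w (g : List ℕ → ℕ) → sum (map g (removeCorners (shape w))) ≡ sumSlides (g ∘ shape) w
removeCorners-shape [] g = refl
removeCorners-shape (false ∷ w) g = removeCorners-shape w g
removeCorners-shape (true ∷ []) g = refl
removeCorners-shape (true ∷ false ∷ w) g = begin
  sum (map g (removeCorners (suc (gaps w) ∷ shape w)))
    ≡⟨ cong (sum ∘ map g) (removeCorners-longest (suc (gaps w))
                             (All.map s≤s (shape-bounded w)) (shape-positive w)) ⟩
  g (prepend (gaps w) (shape w)) + sum (map g (map (suc (gaps w) ∷_) (removeCorners (shape w))))
    ≡⟨ cong (g (prepend (gaps w) (shape w)) +_) (sum-map-∘ g (suc (gaps w) ∷_) (removeCorners (shape w))) ⟩
  g (prepend (gaps w) (shape w)) + sum (map (g ∘ (suc (gaps w) ∷_)) (removeCorners (shape w)))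
    ≡⟨ cong (g (prepend (gaps w) (shape w)) +_) (removeCorners-shape w (g ∘ (suc (gaps w) ∷_))) ⟩
  g (prepend (gaps w) (shape w)) + sumSlides (λ t → g (suc (gaps w) ∷ shape t)) w
    ≡⟨ cong (g (prepend (gaps w) (shape w)) +_) (slideSum-cong w (allSlides-oneBoxLess w
         (λ t p → cong (λ k → g (suc k ∷ shape t)) (sym (gaps≡ p))))) ⟩
  sumSlides (g ∘ shape) (true ∷ false ∷ w) ∎
  where open ≡-Reasoning
removeCorners-shape (true ∷ true ∷ w) g = twoTopBeads (removeCorners-shape (true ∷ w)) (gaps w) refl
  where
  twoTopBeads : (∀ g′ → sum (map g′ (removeCorners (shape (true ∷ w)))) ≡ sumSlides (g′ ∘ shape) (true ∷ w)) →
                ∀ k → gaps w ≡ k →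
                sum (map g (removeCorners (prepend k (prepend k (shape w))))) ≡ sumSlides (g ∘ shape) (true ∷ true ∷ w)
  twoTopBeads _ zero eq rewrite gaps≡0⇒shape≡[] w eq =
    sym (slideSum-weight≡0 (g ∘ shape ∘ (true ∷_)) (true ∷ w)
          (trans (weight-bead w) (cong₂ _+_ eq (cong size (gaps≡0⇒shape≡[] w eq)))))
  twoTopBeads ih (suc k) eq = begin
    sum (map g (removeCorners (suc k ∷ suc k ∷ shape w)))
      ≡⟨ cong (sum ∘ map g) (removeCorners-repeated (suc k) (shape w)) ⟩
    sum (map g (map (suc k ∷_) (removeCorners (suc k ∷ shape w))))
      ≡⟨ sum-map-∘ g (suc k ∷_) (removeCorners (suc k ∷ shape w)) ⟩
    sum (map (g ∘ (suc k ∷_)) (removeCorners (suc k ∷ shape w)))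
      ≡⟨ cong (λ j → sum (map (g ∘ (suc k ∷_)) (removeCorners (prepend j (shape w))))) eq ⟨
    sum (map (g ∘ (suc k ∷_)) (removeCorners (shape (true ∷ w))))
      ≡⟨ ih (g ∘ (suc k ∷_)) ⟩
    sumSlides (g ∘ (suc k ∷_) ∘ shape) (true ∷ w)
      ≡⟨ slideSum-cong (true ∷ w) (allSlides-oneBoxLess (true ∷ w)
           (λ t p → cong (λ j → g (prepend j (shape t))) (sym (trans (gaps≡ p) eq)))) ⟩
    sumSlides (g ∘ shape) (true ∷ true ∷ w) ∎
    where open ≡-Reasoning

f-removeCorners : ∀ xs {k} → size xs ≡ suc k → f xs ≡ sum (map (sytFuel k) (removeCorners xs))
f-removeCorners (x ∷ xs) eq rewrite eq = refl

f-shape : ∀ w {k} → weight w ≡ suc k → f (shape w) ≡ sumSlides (f ∘ shape) w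
f-shape w {k} eq = begin
  f (shape w)                                        ≡⟨ f-removeCorners (shape w) eq ⟩
  sum (map (sytFuel k) (removeCorners (shape w)))    ≡⟨ removeCorners-shape w (sytFuel k) ⟩
  sumSlides (sytFuel k ∘ shape) w                    ≡⟨ slideSum-cong w (allSlides-oneBoxLess w fuel-suffices) ⟩
  sumSlides (f ∘ shape) w                            ∎
  where
  open ≡-Reasoning
  fuel-suffices : ∀ t → OneBoxLess w t → sytFuel k (shape t) ≡ f (shape t)
  fuel-suffices t p = cong (λ n → sytFuel n (shape t)) (ℕ.suc-injective (trans (sym eq) (sym (weight≡ p))))

oddSYT : List ℕ → Bool
oddSYT = isOdd ∘ f

isOdd-sumSlides : ∀ (G : Word → ℕ) w → isOdd (sumSlides G w) ≡ xorSlides (isOdd ∘ G) w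
isOdd-sumSlides G w = sym (slideSum-homomorphic isOdd isOdd-+ refl G w)

oddSYT-slides : ∀ w {k} → weight w ≡ suc k → oddSYT (shape w) ≡ xorSlides (oddSYT ∘ shape) w
oddSYT-slides w eq = trans (cong isOdd (f-shape w eq)) (isOdd-sumSlides (f ∘ shape) w)

-- Slides and dominoes modulo 2

xor-cancelˡ : ∀ b c → b xor (b xor c) ≡ c
xor-cancelˡ false c = refl
xor-cancelˡ true c = Bool.not-involutive c

xor-cancel-middle : ∀ a b c → (a xor b) xor (b xor c) ≡ a xor c
xor-cancel-middle a b c = trans (Bool.xor-assoc a b (b xor c)) (cong (a xor_) (xor-cancelˡ b c))

slideTop : (Word → Bool) → Word → Bool
slideTop F (false ∷ v) = F (false ∷ true ∷ v)
slideTop F _ = false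

xorSlides-bead : ∀ (F : Word → Bool) v → xorSlides F (true ∷ v) ≡ slideTop F v xor xorSlides (F ∘ (true ∷_)) v
xorSlides-bead F [] = refl
xorSlides-bead F (false ∷ v) = refl
xorSlides-bead F (true ∷ v) = refl

-- Two slides of different beads can be made in either order, so modulo 2
-- such pairs cancel.  What remains is a bead sliding twice, or a bead
-- following the bead below it into the place just vacated: one domino each.
xorSlides²≡xorDominoes : ∀ w (F : Word → Bool) → xorSlides (xorSlides F) w ≡ xorDominoes F w
xorSlides²≡xorDominoes [] F = refl
xorSlides²≡xorDominoes (false ∷ w) F = xorSlides²≡xorDominoes w (F ∘ (false ∷_))
xorSlides²≡xorDominoes (true ∷ []) F = refl
xorSlides²≡xorDominoes (true ∷ false ∷ w) F = begin
  xorSlides (F ∘ (false ∷_)) (true ∷ w) xor xorSlides (λ t → F (false ∷ true ∷ t) xor xorSlides F′ t) w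
    ≡⟨ cong (xorSlides (F ∘ (false ∷_)) (true ∷ w) xor_) (XorSlides.slideSum-∙ (λ t → F (false ∷ true ∷ t)) (xorSlides F′) w) ⟩
  xorSlides (F ∘ (false ∷_)) (true ∷ w) xor (xorSlides (λ t → F (false ∷ true ∷ t)) w xor xorSlides (xorSlides F′) w)
    ≡⟨ cong (λ x → xorSlides (F ∘ (false ∷_)) (true ∷ w) xor (xorSlides (λ t → F (false ∷ true ∷ t)) w xor x))
            (xorSlides²≡xorDominoes w F′) ⟩
  xorSlides (F ∘ (false ∷_)) (true ∷ w) xor (xorSlides (λ t → F (false ∷ true ∷ t)) w xor xorDominoes F′ w)
    ≡⟨ collect w ⟩
  xorDominoes F (true ∷ false ∷ w) ∎
  where
  open ≡-Reasoning
  F′ : Word → Bool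
  F′ = F ∘ (true ∷_) ∘ (false ∷_)
  collect : ∀ w → xorSlides (F ∘ (false ∷_)) (true ∷ w) xor (xorSlides (λ t → F (false ∷ true ∷ t)) w xor xorDominoes F′ w)
                  ≡ xorDominoes F (true ∷ false ∷ w)
  collect [] = refl
  collect (false ∷ w) = xor-cancel-middle (F (false ∷ false ∷ true ∷ w)) (xorSlides (λ s → F (false ∷ true ∷ false ∷ s)) w)
                                          (xorDominoes (λ s → F (true ∷ false ∷ false ∷ s)) w)
  collect (true ∷ w) = xor-cancelˡ (xorSlides (λ s → F (false ∷ true ∷ s)) (true ∷ w)) (xorDominoes F′ (true ∷ w))
xorSlides²≡xorDominoes (true ∷ true ∷ w) F = begin
  xorSlides (λ t → xorSlides F (true ∷ t)) (true ∷ w)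
    ≡⟨ slideSum-cong (true ∷ w) (allSlides-universal (xorSlides-bead F) (true ∷ w)) ⟩
  xorSlides (λ t → slideTop F t xor xorSlides (F ∘ (true ∷_)) t) (true ∷ w)
    ≡⟨ XorSlides.slideSum-∙ (slideTop F) (xorSlides (F ∘ (true ∷_))) (true ∷ w) ⟩
  xorSlides (slideTop F) (true ∷ w) xor xorSlides (xorSlides (F ∘ (true ∷_))) (true ∷ w)
    ≡⟨ cong (xorSlides (slideTop F) (true ∷ w) xor_) (xorSlides²≡xorDominoes (true ∷ w) (F ∘ (true ∷_))) ⟩
  xorSlides (slideTop F) (true ∷ w) xor xorDominoes (F ∘ (true ∷_)) (true ∷ w)
    ≡⟨ collect w ⟩
  xorDominoes F (true ∷ true ∷ w) ∎
  where
  open ≡-Reasoning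
  collect : ∀ w → xorSlides (slideTop F) (true ∷ w) xor xorDominoes (F ∘ (true ∷_)) (true ∷ w) ≡ xorDominoes F (true ∷ true ∷ w)
  collect [] = refl
  collect (false ∷ w) = trans (cong (λ x → (F (false ∷ true ∷ true ∷ w) xor x) xor D) (XorSlides.slideSum-ε w))
                              (cong (_xor D) (Bool.xor-identityʳ (F (false ∷ true ∷ true ∷ w))))
    where
    D : Bool
    D = xorDominoes (F ∘ (true ∷_)) (true ∷ false ∷ w)
  collect (true ∷ w) = cong (_xor xorDominoes (F ∘ (true ∷_)) (true ∷ true ∷ w)) (XorSlides.slideSum-ε (true ∷ w))

oddSYT-dominoes : ∀ w → oddSYT (shape w) ≡ xorDominoes (oddSYT ∘ shape) w xor (weight w ≤ᵇ 1)
oddSYT-dominoes w = byWeight (weight w) refl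
  where
  byWeight : ∀ n → weight w ≡ n → oddSYT (shape w) ≡ xorDominoes (oddSYT ∘ shape) w xor (n ≤ᵇ 1)
  byWeight zero eq = begin
    oddSYT (shape w)                                  ≡⟨ cong oddSYT (weight≡0⇒shape≡[] w eq) ⟩
    true                                              ≡⟨ cong (_xor true) (slideSum-weight≡0 (xorSlides (oddSYT ∘ shape)) w eq) ⟨
    xorSlides (xorSlides (oddSYT ∘ shape)) w xor true ≡⟨ cong (_xor true) (xorSlides²≡xorDominoes w (oddSYT ∘ shape)) ⟩
    xorDominoes (oddSYT ∘ shape) w xor true           ∎
    where open ≡-Reasoning
  byWeight (suc zero) eq = begin
    oddSYT (shape w)                                  ≡⟨ cong oddSYT (positive-size≡1 (shape-positive w) eq) ⟩
    true                                              ≡⟨ cong (_xor true) (XorSlides.slideSum-ε w) ⟨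
    xorSlides (λ _ → false) w xor true                ≡⟨ cong (_xor true) (slideSum-cong w (allSlides-oneBoxLess w no-second-slide)) ⟨
    xorSlides (xorSlides (oddSYT ∘ shape)) w xor true ≡⟨ cong (_xor true) (xorSlides²≡xorDominoes w (oddSYT ∘ shape)) ⟩
    xorDominoes (oddSYT ∘ shape) w xor true           ∎
    where
    open ≡-Reasoning
    no-second-slide : ∀ t → OneBoxLess w t → xorSlides (oddSYT ∘ shape) t ≡ false
    no-second-slide t p = slideSum-weight≡0 (oddSYT ∘ shape) t (ℕ.suc-injective (trans (weight≡ p) eq))
  byWeight (suc (suc k)) eq = begin
    oddSYT (shape w)                                   ≡⟨ oddSYT-slides w eq ⟩
    xorSlides (oddSYT ∘ shape) w                       ≡⟨ slideSum-cong w (allSlides-oneBoxLess w second-slide) ⟩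
    xorSlides (xorSlides (oddSYT ∘ shape)) w           ≡⟨ xorSlides²≡xorDominoes w (oddSYT ∘ shape) ⟩
    xorDominoes (oddSYT ∘ shape) w                     ≡⟨ Bool.xor-identityʳ _ ⟨
    xorDominoes (oddSYT ∘ shape) w xor false           ∎
    where
    open ≡-Reasoning
    second-slide : ∀ t → OneBoxLess w t → oddSYT (shape t) ≡ xorSlides (oddSYT ∘ shape) t
    second-slide t p = oddSYT-slides t (ℕ.suc-injective (trans (weight≡ p) eq))

-- Binomial coefficients modulo 2

-- shuffles m n = binomial (m + n) m, the number of interleavings of m and n letters.
shuffles : ℕ → ℕ → ℕ
shuffles zero n = 1
shuffles (suc m) zero = 1
shuffles (suc m) (suc n) = shuffles m (suc n) + shuffles (suc m) n

oddShuffles : ℕ → ℕ → Bool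
oddShuffles m n = isOdd (shuffles m n)

shuffles-zeroʳ : ∀ m → shuffles m 0 ≡ 1
shuffles-zeroʳ zero = refl
shuffles-zeroʳ (suc m) = refl

oddShuffles-pascal : ∀ m n → 0 < m + n →
  ((0 <ᵇ m) ∧ oddShuffles (ℕ.pred m) n) xor ((0 <ᵇ n) ∧ oddShuffles m (ℕ.pred n)) ≡ oddShuffles m n
oddShuffles-pascal zero (suc n) _ = refl
oddShuffles-pascal (suc m) zero _ = cong (λ k → isOdd k xor false) (shuffles-zeroʳ m)
oddShuffles-pascal (suc m) (suc n) _ = sym (isOdd-+ (shuffles m (suc n)) (shuffles (suc m) n))

shuffles-oneˡ : ∀ n → shuffles 1 n ≡ suc n
shuffles-oneˡ zero = refl
shuffles-oneˡ (suc n) = cong suc (shuffles-oneˡ n)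

shuffles-oneʳ : ∀ m → shuffles m 1 ≡ suc m
shuffles-oneʳ zero = refl
shuffles-oneʳ (suc m) = trans (cong (_+ 1) (shuffles-oneʳ m)) (ℕ.+-comm (suc m) 1)

-- Lucas' theorem modulo 2, one binary digit at a time.
oddShuffles-digits : ∀ i j a b →
  oddShuffles (toDigit i + double a) (toDigit j + double b) ≡ not (i ∧ j) ∧ oddShuffles a b
oddShuffles-digits false j zero b = refl
oddShuffles-digits true j zero b =
  trans (cong isOdd (shuffles-oneˡ (toDigit j + double b)))
        (trans (cong not (isOdd-toDigit+double j b)) (sym (Bool.∧-identityʳ (not j))))
oddShuffles-digits i false (suc a) zero =
  trans (cong isOdd (shuffles-zeroʳ (toDigit i + double (suc a)))) (sym (cong (λ x → not x ∧ true) (Bool.∧-zeroʳ i)))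
oddShuffles-digits i true (suc a) zero =
  trans (cong isOdd (shuffles-oneʳ (toDigit i + double (suc a))))
        (trans (cong not (isOdd-toDigit+double i (suc a)))
               (sym (trans (cong (λ x → not x ∧ true) (Bool.∧-identityʳ i)) (Bool.∧-identityʳ (not i)))))
oddShuffles-digits i j (suc a) (suc b) = begin
  oddShuffles (toDigit i + double (suc a)) (toDigit j + double (suc b))
    ≡⟨ cong₂ oddShuffles (toDigit-+-suc² i (double a)) (toDigit-+-suc² j (double b)) ⟩
  oddShuffles (2 + m) (2 + n)
    ≡⟨ isOdd-+ (shuffles (suc m) (2 + n)) (shuffles (2 + m) (suc n)) ⟩
  isOdd (shuffles m (2 + n) + X) xor isOdd (X + shuffles (2 + m) n)
    ≡⟨ cong₂ _xor_ (isOdd-+ (shuffles m (2 + n)) X) (isOdd-+ X (shuffles (2 + m) n)) ⟩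
  (oddShuffles m (2 + n) xor isOdd X) xor (isOdd X xor oddShuffles (2 + m) n)
    ≡⟨ xor-cancel-middle (oddShuffles m (2 + n)) (isOdd X) (oddShuffles (2 + m) n) ⟩
  oddShuffles m (2 + n) xor oddShuffles (2 + m) n
    ≡⟨ cong₂ _xor_ (trans (cong (oddShuffles m) (sym (toDigit-+-suc² j (double b)))) (oddShuffles-digits i j a (suc b)))
                   (trans (cong (λ k → oddShuffles k n) (sym (toDigit-+-suc² i (double a)))) (oddShuffles-digits i j (suc a) b)) ⟩
  (not (i ∧ j) ∧ oddShuffles a (suc b)) xor (not (i ∧ j) ∧ oddShuffles (suc a) b)
    ≡⟨ Bool.∧-distribˡ-xor (not (i ∧ j)) _ _ ⟨
  not (i ∧ j) ∧ (oddShuffles a (suc b) xor oddShuffles (suc a) b)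
    ≡⟨ cong (not (i ∧ j) ∧_) (isOdd-+ (shuffles a (suc b)) (shuffles (suc a) b)) ⟨
  not (i ∧ j) ∧ oddShuffles (suc a) (suc b) ∎
  where
  open ≡-Reasoning
  m n X : ℕ
  m = toDigit i + double a
  n = toDigit j + double b
  X = shuffles (suc m) (suc n)

oddShuffles-halve : ∀ m n → oddShuffles m n ≡ not (isOdd m ∧ isOdd n) ∧ oddShuffles ⌊ m /2⌋ ⌊ n /2⌋
oddShuffles-halve m n = trans (cong₂ oddShuffles (n≡toDigit+double m) (n≡toDigit+double n))
                              (oddShuffles-digits (isOdd m) (isOdd n) ⌊ m /2⌋ ⌊ n /2⌋)

bit-zero : ∀ k → bit k 0 ≡ 0
bit-zero zero = refl
bit-zero (suc k) = bit-zero k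

bit-suc : ∀ k n → bit (suc k) n ≡ bit k ⌊ n /2⌋
bit-suc k n = cong (bit k) (n/2≡⌊n/2⌋ n)

BinDisjoint-zeroˡ : ∀ n → BinDisjoint 0 n
BinDisjoint-zeroˡ n k (bit≡1 , _) = ℕ.0≢1+n (trans (sym (bit-zero k)) bit≡1)

BinDisjoint-halve : ∀ m n → BinDisjoint m n ⇔ (¬ (isOdd m ≡ true × isOdd n ≡ true) × BinDisjoint ⌊ m /2⌋ ⌊ n /2⌋)
BinDisjoint-halve m n = mk⇔
  (λ disjoint → (λ (odd-m , odd-n) → disjoint 0 (isOdd⇒Odd m odd-m , isOdd⇒Odd n odd-n)) ,
                (λ k (x , y) → disjoint (suc k) (trans (bit-suc k m) x , trans (bit-suc k n) y)))
  λ { (¬both , _) zero (x , y) → ¬both (Odd⇒isOdd m x , Odd⇒isOdd n y)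
    ; (_ , disjoint) (suc k) (x , y) → disjoint k (trans (sym (bit-suc k m)) x , trans (sym (bit-suc k n)) y) }

not∧-∧≡true : ∀ a b c → (not (a ∧ b) ∧ c ≡ true) ⇔ (¬ (a ≡ true × b ≡ true) × c ≡ true)
not∧-∧≡true a b c = mk⇔ (to a b c) (from a b c)
  where
  to : ∀ a b c → not (a ∧ b) ∧ c ≡ true → ¬ (a ≡ true × b ≡ true) × c ≡ true
  to false b true _ = (λ ()) , refl
  to true false true _ = (λ ()) , refl
  from : ∀ a b c → ¬ (a ≡ true × b ≡ true) × c ≡ true → not (a ∧ b) ∧ c ≡ true
  from false b c (_ , c≡true) = c≡true
  from true false c (_ , c≡true) = c≡true
  from true true c (¬both , _) = ⊥-elim (¬both (refl , refl))

≡true-cong : ∀ {x y} → x ≡ y → (x ≡ true) ⇔ (y ≡ true)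
≡true-cong x≡y = mk⇔ (trans (sym x≡y)) (trans x≡y)

oddShuffles⇔BinDisjoint : ∀ m n → (oddShuffles m n ≡ true) ⇔ BinDisjoint m n
oddShuffles⇔BinDisjoint m = withFuel m ℕ.≤-refl
  where
  withFuel : ∀ fuel {m} → m ≤ fuel → ∀ n → (oddShuffles m n ≡ true) ⇔ BinDisjoint m n
  withFuel _ {zero} _ n = mk⇔ (λ _ → BinDisjoint-zeroˡ n) (λ _ → refl)
  withFuel (suc fuel) {suc m} (s≤s m≤fuel) n =
    ⇔-trans (≡true-cong (oddShuffles-halve (suc m) n))
    (⇔-trans (not∧-∧≡true (isOdd (suc m)) (isOdd n) _)
    (⇔-trans (⇔-id _ ×-⇔ withFuel fuel (ℕ.≤-trans (ℕ.≤-pred (ℕ.⌊n/2⌋<n m)) m≤fuel) ⌊ n /2⌋)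
             (⇔-sym (BinDisjoint-halve (suc m) n))))

BinDisjoint-sym : ∀ {m n} → BinDisjoint m n → BinDisjoint n m
BinDisjoint-sym disjoint k (x , y) = disjoint k (y , x)

bit-double : ∀ k a → bit (suc k) (2 * a) ≡ bit k a
bit-double k a = cong (bit k) (trans (cong (_/ 2) (sym (double≡2* a))) (double/2 a))

bit0-double : ∀ a → bit 0 (2 * a) ≡ 0
bit0-double a = trans (cong (_% 2) (sym (double≡2* a))) (double%2 a)

BinDisjoint-double⁻ : ∀ {a b} → BinDisjoint (2 * a) (2 * b) → BinDisjoint a b
BinDisjoint-double⁻ {a} {b} disjoint k (x , y) = disjoint (suc k) (trans (bit-double k a) x , trans (bit-double k b) y)

BinDisjoint-double⁺ : ∀ {a b} → BinDisjoint a b → BinDisjoint (2 * a) (2 * b)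
BinDisjoint-double⁺ {a} _ zero (x , _) = ℕ.0≢1+n (trans (sym (bit0-double a)) x)
BinDisjoint-double⁺ {a} {b} disjoint (suc k) (x , y) =
  disjoint k (trans (sym (bit-double k a)) x , trans (sym (bit-double k b)) y)

BinDisjoint-≤1 : ∀ {a} m → a ≤ 1 → BinDisjoint a (2 * m)
BinDisjoint-≤1 m _ zero (_ , y) = ℕ.0≢1+n (trans (sym (bit0-double m)) y)
BinDisjoint-≤1 {zero} m _ (suc k) (x , _) = ℕ.0≢1+n (trans (sym (bit-zero k)) x)
BinDisjoint-≤1 {suc zero} m _ (suc k) (x , _) = ℕ.0≢1+n (trans (sym (bit-zero k)) x)
BinDisjoint-≤1 {suc (suc _)} m (s≤s ()) (suc k) _

-- The parity of f on a 2-abacus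

lowBeads : ℕ → ℕ → Word
lowBeads zero c = []
lowBeads (suc n) c = (n <ᵇ c) ∷ lowBeads n c

lowBeads-saturated : ∀ n {c c′} → n ≤ c → n ≤ c′ → lowBeads n c ≡ lowBeads n c′
lowBeads-saturated zero _ _ = refl
lowBeads-saturated (suc n) n<c n<c′ = cong₂ _∷_ (trans (<ᵇ-true n<c) (sym (<ᵇ-true n<c′)))
  (lowBeads-saturated n (ℕ.≤-trans (ℕ.n≤1+n n) n<c) (ℕ.≤-trans (ℕ.n≤1+n n) n<c′))

settle : Word → Word
settle w = lowBeads (length w) (beads w)

weight≡0⇒settled : ∀ w → weight w ≡ 0 → w ≡ settle w
weight≡0⇒settled [] _ = refl
weight≡0⇒settled (false ∷ w) eq = cong₂ _∷_ (sym (<ᵇ-false (beads≤length w))) (weight≡0⇒settled w eq)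
weight≡0⇒settled (true ∷ w) eq =
  cong₂ _∷_ (sym (<ᵇ-true (s≤s length≤beads)))
            (trans (weight≡0⇒settled w weight≡0) (lowBeads-saturated (length w) length≤beads (ℕ.m≤n⇒m≤1+n length≤beads)))
  where
  gaps≡0 : gaps w ≡ 0
  gaps≡0 = ℕ.m+n≡0⇒m≡0 (gaps w) (trans (sym (weight-bead w)) eq)
  weight≡0 : weight w ≡ 0
  weight≡0 = ℕ.m+n≡0⇒n≡0 (gaps w) (trans (sym (weight-bead w)) eq)
  length≤beads : length w ≤ beads w
  length≤beads = ℕ.≤-reflexive (trans (sym (gaps+beads≡length w)) (cong (_+ beads w) gaps≡0))

oneBoxLess⇒settle≡ : ∀ {w t} → OneBoxLess w t → settle t ≡ settle w
oneBoxLess⇒settle≡ p = cong₂ lowBeads (length≡ p) (beads≡ p)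

coreWeight : Word → Word → ℕ
coreWeight u v = weight (interleave (settle u) (settle v))

InterleaveParity : Word → Word → Set
InterleaveParity u v = oddSYT (shape (interleave u v)) ≡
  (coreWeight u v ≤ᵇ 1) ∧ (oddShuffles (weight u) (weight v) ∧ (oddSYT (shape u) ∧ oddSYT (shape v)))

xorSlides-oddSYT : ∀ w → xorSlides (oddSYT ∘ shape) w ≡ (0 <ᵇ weight w) ∧ oddSYT (shape w)
xorSlides-oddSYT w = byWeight (weight w) refl
  where
  byWeight : ∀ n → weight w ≡ n → xorSlides (oddSYT ∘ shape) w ≡ (0 <ᵇ n) ∧ oddSYT (shape w)
  byWeight zero eq = slideSum-weight≡0 (oddSYT ∘ shape) w eq
  byWeight (suc n) eq = sym (oddSYT-slides w eq)

xorSlides-factor : ∀ (G : Word → Bool) K w → (∀ s → OneBoxLess w s → G s ≡ K ∧ oddSYT (shape s)) →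
                   xorSlides G w ≡ K ∧ ((0 <ᵇ weight w) ∧ oddSYT (shape w))
xorSlides-factor G K w G≡ = begin
  xorSlides G w                            ≡⟨ slideSum-cong w (allSlides-oneBoxLess w G≡) ⟩
  xorSlides ((K ∧_) ∘ oddSYT ∘ shape) w    ≡⟨ slideSum-homomorphic (K ∧_) (Bool.∧-distribˡ-xor K) (Bool.∧-zeroʳ K) (oddSYT ∘ shape) w ⟩
  K ∧ xorSlides (oddSYT ∘ shape) w         ≡⟨ cong (K ∧_) (xorSlides-oddSYT w) ⟩
  K ∧ ((0 <ᵇ weight w) ∧ oddSYT (shape w)) ∎
  where open ≡-Reasoning

interleaveParity-empty : ∀ {u v} → Balanced u v → weight u ≡ 0 → weight v ≡ 0 → InterleaveParity u v
interleaveParity-empty {u} {v} b u≡0 v≡0 = begin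
  oddSYT (shape (interleave u v))
    ≡⟨ oddSYT-dominoes (interleave u v) ⟩
  xorDominoes (oddSYT ∘ shape) (interleave u v) xor (weight (interleave u v) ≤ᵇ 1)
    ≡⟨ cong (_xor (weight (interleave u v) ≤ᵇ 1)) (XorSlides.dominoSum-interleave b (oddSYT ∘ shape)) ⟩
  (xorSlides _ u xor xorSlides _ v) xor (weight (interleave u v) ≤ᵇ 1)
    ≡⟨ cong₂ (λ x y → (x xor y) xor (weight (interleave u v) ≤ᵇ 1))
             (slideSum-weight≡0 _ u u≡0) (slideSum-weight≡0 _ v v≡0) ⟩
  weight (interleave u v) ≤ᵇ 1
    ≡⟨ cong (λ w → weight w ≤ᵇ 1) (cong₂ interleave (weight≡0⇒settled u u≡0) (weight≡0⇒settled v v≡0)) ⟩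
  coreWeight u v ≤ᵇ 1
    ≡⟨ Bool.∧-identityʳ _ ⟨
  (coreWeight u v ≤ᵇ 1) ∧ true
    ≡⟨ cong₂ (λ k x → (coreWeight u v ≤ᵇ 1) ∧ (oddShuffles k 0 ∧ x)) u≡0 pu∧pv ⟨
  (coreWeight u v ≤ᵇ 1) ∧ (oddShuffles (weight u) 0 ∧ (oddSYT (shape u) ∧ oddSYT (shape v)))
    ≡⟨ cong (λ k → (coreWeight u v ≤ᵇ 1) ∧ (oddShuffles (weight u) k ∧ (oddSYT (shape u) ∧ oddSYT (shape v)))) v≡0 ⟨
  (coreWeight u v ≤ᵇ 1) ∧ (oddShuffles (weight u) (weight v) ∧ (oddSYT (shape u) ∧ oddSYT (shape v))) ∎
  where
  open ≡-Reasoning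
  pu∧pv : oddSYT (shape u) ∧ oddSYT (shape v) ≡ true
  pu∧pv = cong₂ (λ x y → oddSYT x ∧ oddSYT y) (weight≡0⇒shape≡[] u u≡0) (weight≡0⇒shape≡[] v v≡0)

≤ᵇ1-false : ∀ {n} → 2 ≤ n → (n ≤ᵇ 1) ≡ false
≤ᵇ1-false (s≤s (s≤s _)) = refl

slide-exists-either : ∀ u v → 0 < weight u + weight v → 0 < sumSlides (λ _ → 1) u + sumSlides (λ _ → 1) v
slide-exists-either u v 0<a+b with weight u in eq
... | zero = ℕ.≤-trans (slide-exists v 0<a+b) (ℕ.m≤n+m _ _)
... | suc _ = ℕ.≤-trans (slide-exists u (subst (0 <_) (sym eq) (s≤s z≤n))) (ℕ.m≤m+n _ _)

module ∧-Solver = CommutativeMonoidSolver Bool.∧-commutativeMonoid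

∧-extractˡ : ∀ c b x y → c ∧ (b ∧ (x ∧ y)) ≡ (c ∧ (b ∧ y)) ∧ x
∧-extractˡ c b x y = prove 4 (C ⊕ (B ⊕ (X ⊕ Y))) ((C ⊕ (B ⊕ Y)) ⊕ X) (c ∷ b ∷ x ∷ y ∷ [])
  where
  open ∧-Solver using (prove; var; _⊕_)
  C B X Y : ∧-Solver.Expr 4
  C = var (# 0)
  B = var (# 1)
  X = var (# 2)
  Y = var (# 3)

∧-extractʳ : ∀ c b x y → c ∧ (b ∧ (x ∧ y)) ≡ (c ∧ (b ∧ x)) ∧ y
∧-extractʳ c b x y = trans (cong (λ z → c ∧ (b ∧ z)) (Bool.∧-comm x y)) (∧-extractˡ c b y x)

∧-collect : ∀ c b a x y → (c ∧ (b ∧ y)) ∧ (a ∧ x) ≡ c ∧ ((a ∧ b) ∧ (x ∧ y))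
∧-collect c b a x y = prove 5 ((C ⊕ (B ⊕ Y)) ⊕ (A ⊕ X)) (C ⊕ ((A ⊕ B) ⊕ (X ⊕ Y))) (c ∷ b ∷ a ∷ x ∷ y ∷ [])
  where
  open ∧-Solver using (prove; var; _⊕_)
  C B A X Y : ∧-Solver.Expr 5
  C = var (# 0)
  B = var (# 1)
  A = var (# 2)
  X = var (# 3)
  Y = var (# 4)

interleaveParity-slideˡ : ∀ {u v s} → OneBoxLess u s → InterleaveParity s v →
  oddSYT (shape (interleave s v)) ≡
    ((coreWeight u v ≤ᵇ 1) ∧ (oddShuffles (ℕ.pred (weight u)) (weight v) ∧ oddSYT (shape v))) ∧ oddSYT (shape s)
interleaveParity-slideˡ {u} {v} {s} p parity = begin
  oddSYT (shape (interleave s v))                                ≡⟨ parity ⟩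
  (coreWeight s v ≤ᵇ 1) ∧ (oddShuffles (weight s) (weight v) ∧ (ps ∧ pv))
    ≡⟨ cong₂ (λ w k → (weight (interleave w (settle v)) ≤ᵇ 1) ∧ (oddShuffles k (weight v) ∧ (ps ∧ pv)))
             (oneBoxLess⇒settle≡ p) (cong ℕ.pred (weight≡ p)) ⟩
  c ∧ (B ∧ (ps ∧ pv))                                            ≡⟨ ∧-extractˡ c B ps pv ⟩
  (c ∧ (B ∧ pv)) ∧ ps                                            ∎
  where
  open ≡-Reasoning
  c B ps pv : Bool
  c = coreWeight u v ≤ᵇ 1
  B = oddShuffles (ℕ.pred (weight u)) (weight v)
  ps = oddSYT (shape s)
  pv = oddSYT (shape v)

interleaveParity-slideʳ : ∀ {u v s} → OneBoxLess v s → InterleaveParity u s →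
  oddSYT (shape (interleave u s)) ≡
    ((coreWeight u v ≤ᵇ 1) ∧ (oddShuffles (weight u) (ℕ.pred (weight v)) ∧ oddSYT (shape u))) ∧ oddSYT (shape s)
interleaveParity-slideʳ {u} {v} {s} p parity = begin
  oddSYT (shape (interleave u s))                                ≡⟨ parity ⟩
  (coreWeight u s ≤ᵇ 1) ∧ (oddShuffles (weight u) (weight s) ∧ (pu ∧ ps))
    ≡⟨ cong₂ (λ w k → (weight (interleave (settle u) w) ≤ᵇ 1) ∧ (oddShuffles (weight u) k ∧ (pu ∧ ps)))
             (oneBoxLess⇒settle≡ p) (cong ℕ.pred (weight≡ p)) ⟩
  c ∧ (B ∧ (pu ∧ ps))                                            ≡⟨ ∧-extractʳ c B pu ps ⟩
  (c ∧ (B ∧ pu)) ∧ ps                                            ∎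
  where
  open ≡-Reasoning
  c B ps pu : Bool
  c = coreWeight u v ≤ᵇ 1
  B = oddShuffles (weight u) (ℕ.pred (weight v))
  ps = oddSYT (shape s)
  pu = oddSYT (shape u)

interleaveParity-step : ∀ {u v} → Balanced u v → 0 < weight u + weight v →
  (∀ s → OneBoxLess u s → InterleaveParity s v) → (∀ s → OneBoxLess v s → InterleaveParity u s) →
  InterleaveParity u v
interleaveParity-step {u} {v} b 0<a+b ih-u ih-v = begin
  P (interleave u v)
    ≡⟨ oddSYT-dominoes (interleave u v) ⟩
  xorDominoes P (interleave u v) xor (weight (interleave u v) ≤ᵇ 1)
    ≡⟨ cong₂ _xor_ (XorSlides.dominoSum-interleave b P) (≤ᵇ1-false (domino⇒2≤weight (interleave u v) domino-exists)) ⟩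
  (xorSlides (λ s → P (interleave s v)) u xor xorSlides (P ∘ interleave u) v) xor false
    ≡⟨ Bool.xor-identityʳ _ ⟩
  xorSlides (λ s → P (interleave s v)) u xor xorSlides (P ∘ interleave u) v
    ≡⟨ cong₂ _xor_ (xorSlides-factor (λ s → P (interleave s v)) (c ∧ (B₁ ∧ pv)) u (λ s p → interleaveParity-slideˡ {v = v} p (ih-u s p)))
                   (xorSlides-factor (P ∘ interleave u) (c ∧ (B₂ ∧ pu)) v (λ s p → interleaveParity-slideʳ {u} p (ih-v s p))) ⟩
  ((c ∧ (B₁ ∧ pv)) ∧ (α ∧ pu)) xor ((c ∧ (B₂ ∧ pu)) ∧ (β ∧ pv))
    ≡⟨ cong₂ _xor_ (∧-collect c B₁ α pu pv) (trans (∧-collect c B₂ β pv pu) (cong (λ x → c ∧ ((β ∧ B₂) ∧ x)) (Bool.∧-comm pv pu))) ⟩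
  (c ∧ ((α ∧ B₁) ∧ (pu ∧ pv))) xor (c ∧ ((β ∧ B₂) ∧ (pu ∧ pv)))
    ≡⟨ Bool.∧-distribˡ-xor c _ _ ⟨
  c ∧ (((α ∧ B₁) ∧ (pu ∧ pv)) xor ((β ∧ B₂) ∧ (pu ∧ pv)))
    ≡⟨ cong (c ∧_) (Bool.∧-distribʳ-xor (pu ∧ pv) (α ∧ B₁) (β ∧ B₂)) ⟨
  c ∧ (((α ∧ B₁) xor (β ∧ B₂)) ∧ (pu ∧ pv))
    ≡⟨ cong (λ x → c ∧ (x ∧ (pu ∧ pv))) (oddShuffles-pascal (weight u) (weight v) 0<a+b) ⟩
  c ∧ (oddShuffles (weight u) (weight v) ∧ (pu ∧ pv)) ∎
  where
  open ≡-Reasoning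
  P : Word → Bool
  P = oddSYT ∘ shape
  c pu pv α β B₁ B₂ : Bool
  c = coreWeight u v ≤ᵇ 1
  pu = P u
  pv = P v
  α = 0 <ᵇ weight u
  β = 0 <ᵇ weight v
  B₁ = oddShuffles (ℕ.pred (weight u)) (weight v)
  B₂ = oddShuffles (weight u) (ℕ.pred (weight v))
  domino-exists : 0 < sumDominoes (λ _ → 1) (interleave u v)
  domino-exists = subst (0 <_) (sym (SumSlides.dominoSum-interleave b (λ _ → 1))) (slide-exists-either u v 0<a+b)

interleaveParity : ∀ {u v} → Balanced u v → InterleaveParity u v
interleaveParity {u} {v} b = byWeight (weight u + weight v) b refl
  where
  byWeight : ∀ n {u v} → Balanced u v → weight u + weight v ≡ n → InterleaveParity u v
  byWeight zero {u} b eq = interleaveParity-empty b (ℕ.m+n≡0⇒m≡0 (weight u) eq) (ℕ.m+n≡0⇒n≡0 (weight u) eq)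
  byWeight (suc n) {u} {v} b eq = interleaveParity-step b (subst (0 <_) (sym eq) (s≤s z≤n))
    (λ s p → byWeight n {s} {v} (balanced-resize b (length≡ p) refl)
               (ℕ.suc-injective (trans (cong (_+ weight v) (weight≡ p)) eq)))
    (λ s p → byWeight n {u} {s} (balanced-resize b refl (length≡ p))
               (ℕ.suc-injective (trans (sym (ℕ.+-suc (weight u) (weight s))) (trans (cong (weight u +_) (weight≡ p)) eq))))

-- The 2-abacus of a partition

BetaBelow : ℕ → List ℕ → Set
BetaBelow L [] = ⊤
BetaBelow L (b ∷ bs) = b < L × BetaBelow b bs

betaBelow-mono : ∀ {L M} bs → L ≤ M → BetaBelow L bs → BetaBelow M bs
betaBelow-mono [] _ _ = tt
betaBelow-mono (b ∷ bs) L≤M (b<L , below) = ℕ.<-≤-trans b<L L≤M , below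

betaBelow-length : ∀ L bs → BetaBelow L bs → length bs ≤ L
betaBelow-length L [] _ = z≤n
betaBelow-length L (b ∷ bs) (b<L , below) = ℕ.≤-trans (s≤s (betaBelow-length b bs below)) b<L

betaBelow-addIf : ∀ L x bs → BetaBelow L bs → BetaBelow (suc L) (addIf x L bs)
betaBelow-addIf L true bs below = ℕ.n<1+n L , below
betaBelow-addIf L false bs below = betaBelow-mono bs (ℕ.n≤1+n L) below

abacusWord : ℕ → List ℕ → Word
abacusWord zero bs = []
abacusWord (suc L) [] = false ∷ abacusWord L []
abacusWord (suc L) (b ∷ bs) = if b ℕ.≡ᵇ L then true ∷ abacusWord L bs else false ∷ abacusWord L (b ∷ bs)

record Peeled (L : ℕ) (bs : List ℕ) : Set where
  constructor peeled
  field
    occupied : Bool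
    rest : List ℕ
    rest-below : BetaBelow L rest
    bs≡ : bs ≡ addIf occupied L rest

peel : ∀ L bs → BetaBelow (suc L) bs → Peeled L bs
peel L [] _ = peeled false [] tt refl
peel L (b ∷ bs) (b<1+L , below) with b ℕ.≟ L
... | yes refl = peeled true bs below refl
... | no b≢L = peeled false (b ∷ bs) (ℕ.≤∧≢⇒< (ℕ.≤-pred b<1+L) b≢L , below) refl

≡ᵇ-refl : ∀ n → (n ℕ.≡ᵇ n) ≡ true
≡ᵇ-refl zero = refl
≡ᵇ-refl (suc n) = ≡ᵇ-refl n

<⇒≡ᵇ-false : ∀ {m n} → m < n → (m ℕ.≡ᵇ n) ≡ false
<⇒≡ᵇ-false {zero} (s≤s _) = refl
<⇒≡ᵇ-false {suc m} (s≤s m<n) = <⇒≡ᵇ-false m<n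

abacusWord-addIf : ∀ L x bs → BetaBelow L bs → abacusWord (suc L) (addIf x L bs) ≡ x ∷ abacusWord L bs
abacusWord-addIf L true bs _ rewrite ≡ᵇ-refl L = refl
abacusWord-addIf L false [] _ = refl
abacusWord-addIf L false (b ∷ bs) (b<L , _) rewrite <⇒≡ᵇ-false b<L = refl

length-abacusWord : ∀ L bs → length (abacusWord L bs) ≡ L
length-abacusWord zero bs = refl
length-abacusWord (suc L) [] = cong suc (length-abacusWord L [])
length-abacusWord (suc L) (b ∷ bs) with b ℕ.≡ᵇ L
... | true = cong suc (length-abacusWord L bs)
... | false = cong suc (length-abacusWord L (b ∷ bs))

beads-abacusWord : ∀ L bs → BetaBelow L bs → beads (abacusWord L bs) ≡ length bs
beads-abacusWord zero [] _ = refl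
beads-abacusWord (suc L) bs below with peel L bs below
... | peeled true rest rest-below refl =
  trans (cong beads (abacusWord-addIf L true rest rest-below)) (cong suc (beads-abacusWord L rest rest-below))
... | peeled false rest rest-below refl =
  trans (cong beads (abacusWord-addIf L false rest rest-below)) (beads-abacusWord L rest rest-below)

gaps-abacusWord : ∀ L bs → BetaBelow L bs → gaps (abacusWord L bs) ≡ L ∸ length bs
gaps-abacusWord L bs below = begin
  gaps w                          ≡⟨ ℕ.m+n∸n≡m (gaps w) (beads w) ⟨
  gaps w + beads w ∸ beads w      ≡⟨ cong₂ _∸_ (trans (gaps+beads≡length w) (length-abacusWord L bs)) (beads-abacusWord L bs below) ⟩
  L ∸ length bs                   ∎
  where
  open ≡-Reasoning
  w : Word
  w = abacusWord L bs

shape-abacusWord : ∀ L bs → BetaBelow L bs → shape (abacusWord L bs) ≡ betaToPartition bs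
shape-abacusWord zero [] _ = refl
shape-abacusWord (suc L) bs below with peel L bs below
... | peeled true rest rest-below refl = begin
  shape (abacusWord (suc L) (L ∷ rest))                        ≡⟨ cong shape (abacusWord-addIf L true rest rest-below) ⟩
  prepend (gaps (abacusWord L rest)) (shape (abacusWord L rest)) ≡⟨ cong₂ prepend (gaps-abacusWord L rest rest-below)
                                                                                   (shape-abacusWord L rest rest-below) ⟩
  prepend (L ∸ length rest) (betaToPartition rest)              ≡⟨ betaToPartition-∷ L rest ⟨
  betaToPartition (L ∷ rest)                                    ∎
  where open ≡-Reasoning
... | peeled false rest rest-below refl =
  trans (cong shape (abacusWord-addIf L false rest rest-below)) (shape-abacusWord L rest rest-below)

runner-addIf-same : ∀ j x b bs → b % 2 ≡ j → runner j (addIf x b bs) ≡ addIf x (b / 2) (runner j bs)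
runner-addIf-same j true b bs refl rewrite ≡ᵇ-refl (b % 2) = refl
runner-addIf-same j false b bs _ = refl

runner-addIf-other : ∀ j x b bs → (b % 2 ℕ.≡ᵇ j) ≡ false → runner j (addIf x b bs) ≡ runner j bs
runner-addIf-other j true b bs b%2≢j rewrite b%2≢j = refl
runner-addIf-other j false b bs _ = refl

runners-addIf² : ∀ K x₁ x₀ bs → let bs′ = addIf x₁ (suc (double K)) (addIf x₀ (double K) bs) in
  runner 1 bs′ ≡ addIf x₁ K (runner 1 bs) × runner 0 bs′ ≡ addIf x₀ K (runner 0 bs)
runners-addIf² K x₁ x₀ bs =
  trans (runner-addIf-same 1 x₁ _ _ (1+double%2 K))
        (cong₂ (addIf x₁) (1+double/2 K) (runner-addIf-other 1 x₀ _ bs (cong (ℕ._≡ᵇ 1) (double%2 K)))) ,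
  trans (runner-addIf-other 0 x₁ _ _ (cong (ℕ._≡ᵇ 0) (1+double%2 K)))
        (trans (runner-addIf-same 0 x₀ _ bs (double%2 K)) (cong (λ k → addIf x₀ k (runner 0 bs)) (double/2 K)))

betaBelow-runners : ∀ K bs → BetaBelow (double K) bs → BetaBelow K (runner 1 bs) × BetaBelow K (runner 0 bs)
betaBelow-runners zero [] _ = tt , tt
betaBelow-runners (suc K) bs below with peel (suc (double K)) bs below
... | peeled x₁ bs₁ below₁ refl with peel (double K) bs₁ below₁
... | peeled x₀ bs₀ below₀ refl =
  let (runner₁≡ , runner₀≡) = runners-addIf² K x₁ x₀ bs₀
      (below-runner₁ , below-runner₀) = betaBelow-runners K bs₀ below₀
  in subst (BetaBelow (suc K)) (sym runner₁≡) (betaBelow-addIf K x₁ _ below-runner₁) ,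
     subst (BetaBelow (suc K)) (sym runner₀≡) (betaBelow-addIf K x₀ _ below-runner₀)

abacusWord-runners : ∀ K bs → BetaBelow (double K) bs →
                     abacusWord (double K) bs ≡ interleave (abacusWord K (runner 1 bs)) (abacusWord K (runner 0 bs))
abacusWord-runners zero [] _ = refl
abacusWord-runners (suc K) bs below with peel (suc (double K)) bs below
... | peeled x₁ bs₁ below₁ refl with peel (double K) bs₁ below₁
... | peeled x₀ bs₀ below₀ refl = begin
  abacusWord (suc (suc (double K))) (addIf x₁ (suc (double K)) bs₁)
    ≡⟨ abacusWord-addIf (suc (double K)) x₁ bs₁ below₁ ⟩
  x₁ ∷ abacusWord (suc (double K)) (addIf x₀ (double K) bs₀)
    ≡⟨ cong (x₁ ∷_) (abacusWord-addIf (double K) x₀ bs₀ below₀) ⟩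
  x₁ ∷ x₀ ∷ abacusWord (double K) bs₀
    ≡⟨ cong (λ w → x₁ ∷ x₀ ∷ w) (abacusWord-runners K bs₀ below₀) ⟩
  interleave (x₁ ∷ abacusWord K (runner 1 bs₀)) (x₀ ∷ abacusWord K (runner 0 bs₀))
    ≡⟨ cong₂ interleave (abacusWord-addIf K x₁ _ (proj₁ (betaBelow-runners K bs₀ below₀)))
                        (abacusWord-addIf K x₀ _ (proj₂ (betaBelow-runners K bs₀ below₀))) ⟨
  interleave (abacusWord (suc K) (addIf x₁ K (runner 1 bs₀))) (abacusWord (suc K) (addIf x₀ K (runner 0 bs₀)))
    ≡⟨ cong₂ (λ r₁ r₀ → interleave (abacusWord (suc K) r₁) (abacusWord (suc K) r₀))
             (proj₁ (runners-addIf² K x₁ x₀ bs₀)) (proj₂ (runners-addIf² K x₁ x₀ bs₀)) ⟨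
  interleave (abacusWord (suc K) (runner 1 bs)) (abacusWord (suc K) (runner 0 bs)) ∎
  where open ≡-Reasoning

betaBelow-coreBeta : ∀ c₀ c₁ n → BetaBelow n (coreBeta c₀ c₁ n)
betaBelow-coreBeta c₀ c₁ zero = tt
betaBelow-coreBeta c₀ c₁ (suc n) = betaBelow-addIf n (isCoreBead c₀ c₁ n) _ (betaBelow-coreBeta c₀ c₁ n)

isCoreBead-odd : ∀ c₀ c₁ k → isCoreBead c₀ c₁ (suc (double k)) ≡ (k <ᵇ c₁)
isCoreBead-odd c₀ c₁ k rewrite 1+double%2 k | 1+double/2 k = refl

isCoreBead-even : ∀ c₀ c₁ k → isCoreBead c₀ c₁ (double k) ≡ (k <ᵇ c₀)
isCoreBead-even c₀ c₁ k rewrite double%2 k | double/2 k = refl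

abacusWord-coreBeta : ∀ c₀ c₁ M → abacusWord (double M) (coreBeta c₀ c₁ (double M)) ≡ interleave (lowBeads M c₁) (lowBeads M c₀)
abacusWord-coreBeta c₀ c₁ zero = refl
abacusWord-coreBeta c₀ c₁ (suc M) = begin
  abacusWord (suc (suc (double M))) (addIf (isCoreBead c₀ c₁ (suc (double M))) (suc (double M)) core₁)
    ≡⟨ abacusWord-addIf (suc (double M)) _ core₁ (betaBelow-coreBeta c₀ c₁ (suc (double M))) ⟩
  isCoreBead c₀ c₁ (suc (double M)) ∷ abacusWord (suc (double M)) (addIf (isCoreBead c₀ c₁ (double M)) (double M) core₀)
    ≡⟨ cong (isCoreBead c₀ c₁ (suc (double M)) ∷_) (abacusWord-addIf (double M) _ core₀ (betaBelow-coreBeta c₀ c₁ (double M))) ⟩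
  isCoreBead c₀ c₁ (suc (double M)) ∷ isCoreBead c₀ c₁ (double M) ∷ abacusWord (double M) core₀
    ≡⟨ cong₂ (λ x₁ x₀ → x₁ ∷ x₀ ∷ abacusWord (double M) core₀) (isCoreBead-odd c₀ c₁ M) (isCoreBead-even c₀ c₁ M) ⟩
  (M <ᵇ c₁) ∷ (M <ᵇ c₀) ∷ abacusWord (double M) core₀
    ≡⟨ cong (λ w → (M <ᵇ c₁) ∷ (M <ᵇ c₀) ∷ w) (abacusWord-coreBeta c₀ c₁ M) ⟩
  interleave (lowBeads (suc M) c₁) (lowBeads (suc M) c₀) ∎
  where
  open ≡-Reasoning
  core₀ core₁ : List ℕ
  core₀ = coreBeta c₀ c₁ (double M)
  core₁ = coreBeta c₀ c₁ (suc (double M))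

-- Extra empty rows at the top of the 2-abacus do not change the diagram.
weight-lowBeads-pad : ∀ d {M c₀ c₁} → c₀ ≤ M → c₁ ≤ M →
  weight (interleave (lowBeads (d + M) c₁) (lowBeads (d + M) c₀)) ≡ weight (interleave (lowBeads M c₁) (lowBeads M c₀))
weight-lowBeads-pad zero _ _ = refl
weight-lowBeads-pad (suc d) {M} c₀≤M c₁≤M
  rewrite <ᵇ-false (ℕ.≤-trans c₁≤M (ℕ.m≤n+m M d)) | <ᵇ-false (ℕ.≤-trans c₀≤M (ℕ.m≤n+m M d)) =
  weight-lowBeads-pad d c₀≤M c₁≤M

weight-lowBeads-height : ∀ {M M′ c₀ c₁} → c₀ ≤ M → c₁ ≤ M → c₀ ≤ M′ → c₁ ≤ M′ →
  weight (interleave (lowBeads M c₁) (lowBeads M c₀)) ≡ weight (interleave (lowBeads M′ c₁) (lowBeads M′ c₀))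
weight-lowBeads-height {M} {M′} {c₀} {c₁} c₀≤M c₁≤M c₀≤M′ c₁≤M′ with ℕ.≤-total M M′
... | inj₁ M≤M′ = sym (trans (cong height (sym (ℕ.m∸n+n≡m M≤M′))) (weight-lowBeads-pad (M′ ∸ M) c₀≤M c₁≤M))
  where
  height : ℕ → ℕ
  height n = weight (interleave (lowBeads n c₁) (lowBeads n c₀))
... | inj₂ M′≤M = trans (cong height (sym (ℕ.m∸n+n≡m M′≤M))) (weight-lowBeads-pad (M ∸ M′) c₀≤M′ c₁≤M′)
  where
  height : ℕ → ℕ
  height n = weight (interleave (lowBeads n c₁) (lowBeads n c₀))

size-core2 : ∀ l K → let c₀ = length (runner 0 (betaSet l)); c₁ = length (runner 1 (betaSet l)) in
  c₀ ≤ K → c₁ ≤ K → size (core2 l) ≡ weight (interleave (lowBeads K c₁) (lowBeads K c₀))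
size-core2 l K c₀≤K c₁≤K = begin
  size (core2 l)
    ≡⟨ cong size (core2≡coreBeta l) ⟩
  size (betaToPartition (coreBeta c₀ c₁ (2 * (c₀ + c₁) + 2)))
    ≡⟨ cong (λ n → size (betaToPartition (coreBeta c₀ c₁ n))) 2*M+2≡double ⟩
  size (betaToPartition (coreBeta c₀ c₁ (double M)))
    ≡⟨ cong size (shape-abacusWord (double M) _ (betaBelow-coreBeta c₀ c₁ (double M))) ⟨
  weight (abacusWord (double M) (coreBeta c₀ c₁ (double M)))
    ≡⟨ cong weight (abacusWord-coreBeta c₀ c₁ M) ⟩
  weight (interleave (lowBeads M c₁) (lowBeads M c₀))
    ≡⟨ weight-lowBeads-height (ℕ.m≤n⇒m≤1+n (ℕ.m≤m+n c₀ c₁)) (ℕ.m≤n⇒m≤1+n (ℕ.m≤n+m c₁ c₀)) c₀≤K c₁≤K ⟩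
  weight (interleave (lowBeads K c₁) (lowBeads K c₀)) ∎
  where
  open ≡-Reasoning
  c₀ c₁ M : ℕ
  c₀ = length (runner 0 (betaSet l))
  c₁ = length (runner 1 (betaSet l))
  M = suc (c₀ + c₁)
  2*M+2≡double : 2 * (c₀ + c₁) + 2 ≡ double M
  2*M+2≡double = trans (ℕ.+-comm (2 * (c₀ + c₁)) 2) (cong (suc ∘ suc) (sym (double≡2* (c₀ + c₁))))

length-betaList : ∀ r l → length (betaList r l) ≡ r
length-betaList zero l = refl
length-betaList (suc r) [] = cong suc (length-betaList r [])
length-betaList (suc r) (x ∷ xs) = cong suc (length-betaList r xs)

betaToPartition-betaList : ∀ r l → length l ≤ r → All (0 <_) l → betaToPartition (betaList r l) ≡ l
betaToPartition-betaList zero [] _ _ = refl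
betaToPartition-betaList (suc r) [] _ _ = begin
  betaToPartition (r ∷ betaList r [])                        ≡⟨ betaToPartition-∷ r (betaList r []) ⟩
  prepend (r ∸ length (betaList r [])) (betaToPartition (betaList r []))
    ≡⟨ cong (λ n → prepend (r ∸ n) (betaToPartition (betaList r []))) (length-betaList r []) ⟩
  prepend (r ∸ r) (betaToPartition (betaList r []))          ≡⟨ cong (λ n → prepend n (betaToPartition (betaList r []))) (ℕ.n∸n≡0 r) ⟩
  betaToPartition (betaList r [])                            ≡⟨ betaToPartition-betaList r [] z≤n [] ⟩
  []                                                         ∎
  where open ≡-Reasoning
betaToPartition-betaList (suc r) (suc x ∷ xs) (s≤s length≤r) (_ ∷ positive) = begin
  betaToPartition ((suc x + r) ∷ betaList r xs)                     ≡⟨ betaToPartition-∷ (suc x + r) (betaList r xs) ⟩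
  prepend (suc x + r ∸ length (betaList r xs)) (betaToPartition (betaList r xs))
    ≡⟨ cong₂ prepend (trans (cong (suc x + r ∸_) (length-betaList r xs)) (ℕ.m+n∸n≡m (suc x) r))
                     (betaToPartition-betaList r xs length≤r positive) ⟩
  suc x ∷ xs                                                        ∎
  where open ≡-Reasoning

betaBelow-betaList : ∀ r M l → Linked (λ a b → b ≤ a) (M ∷ l) → BetaBelow (M + r) (betaList r l)
betaBelow-betaList zero M l _ = tt
betaBelow-betaList (suc r) M [] _ =
  subst (r <_) (sym (ℕ.+-suc M r)) (s≤s (ℕ.m≤n+m r M)) , betaBelow-betaList r 0 [] [-]
betaBelow-betaList (suc r) M (x ∷ xs) (x≤M ∷ linked) =
  subst (x + r <_) (sym (ℕ.+-suc M r)) (s≤s (ℕ.+-monoˡ-≤ r x≤M)) , betaBelow-betaList r x xs linked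

partition-bounded : ∀ l → Linked (λ a b → b ≤ a) l → Linked (λ a b → b ≤ a) (size l ∷ l)
partition-bounded [] _ = [-]
partition-bounded (x ∷ xs) linked = ℕ.m≤m+n x (size xs) ∷ linked

betaSet-below : ∀ l → Linked (λ a b → b ≤ a) l → BetaBelow (double (size l + beadCount l)) (betaSet l)
betaSet-below l linked = subst (BetaBelow _) (sym (betaSet≡betaList l))
  (betaBelow-mono _ (n≤double _) (betaBelow-betaList (beadCount l) (size l) l (partition-bounded l linked)))

betaToPartition-betaSet : ∀ l → All (0 <_) l → betaToPartition (betaSet l) ≡ l
betaToPartition-betaSet l positive = trans (cong betaToPartition (betaSet≡betaList l))
  (betaToPartition-betaList (beadCount l) l (ℕ.m≤m+n (length l) (length l % 2)) positive)

-- Runner j of the 2-abacus of λ is an abacus of μʲ; sliding all its beads down gives the 2-core.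
oddSYT-quotient : ∀ l → IsPartition l → oddSYT l ≡
  (size (core2 l) ≤ᵇ 1) ∧ (oddShuffles (size (quo1 l)) (size (quo0 l)) ∧ (oddSYT (quo1 l) ∧ oddSYT (quo0 l)))
oddSYT-quotient l (linked , positive) = begin
  oddSYT l
    ≡⟨ cong oddSYT (trans (shape-abacusWord (double K) bs below) (betaToPartition-betaSet l positive)) ⟨
  oddSYT (shape (abacusWord (double K) bs))
    ≡⟨ cong (oddSYT ∘ shape) (abacusWord-runners K bs below) ⟩
  oddSYT (shape (interleave u v))
    ≡⟨ interleaveParity (balanced-sameLength u v (trans (length-abacusWord K _) (sym (length-abacusWord K _)))) ⟩
  (coreWeight u v ≤ᵇ 1) ∧ (oddShuffles (weight u) (weight v) ∧ (oddSYT (shape u) ∧ oddSYT (shape v)))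
    ≡⟨ cong₂ (λ c (μ¹ , μ⁰) → (c ≤ᵇ 1) ∧ (oddShuffles (size μ¹) (size μ⁰) ∧ (oddSYT μ¹ ∧ oddSYT μ⁰)))
             coreWeight≡ (cong₂ _,_ (shape-abacusWord K _ below₁) (shape-abacusWord K _ below₀)) ⟩
  (size (core2 l) ≤ᵇ 1) ∧ (oddShuffles (size (quo1 l)) (size (quo0 l)) ∧ (oddSYT (quo1 l) ∧ oddSYT (quo0 l))) ∎
  where
  open ≡-Reasoning
  K : ℕ
  K = size l + beadCount l
  bs : List ℕ
  bs = betaSet l
  below : BetaBelow (double K) bs
  below = betaSet-below l linked
  below₁ : BetaBelow K (runner 1 bs)
  below₁ = proj₁ (betaBelow-runners K bs below)
  below₀ : BetaBelow K (runner 0 bs)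
  below₀ = proj₂ (betaBelow-runners K bs below)
  u v : Word
  u = abacusWord K (runner 1 bs)
  v = abacusWord K (runner 0 bs)
  coreWeight≡ : coreWeight u v ≡ size (core2 l)
  coreWeight≡ = trans (cong₂ (λ t₁ t₀ → weight (interleave t₁ t₀))
                             (cong₂ lowBeads (length-abacusWord K _) (beads-abacusWord K _ below₁))
                             (cong₂ lowBeads (length-abacusWord K _) (beads-abacusWord K _ below₀)))
                      (sym (size-core2 l K (betaBelow-length K _ below₀) (betaBelow-length K _ below₁)))

∧≡true⁻ : ∀ {x y} → x ∧ y ≡ true → x ≡ true × y ≡ true
∧≡true⁻ {true} {true} _ = refl , refl

∧≡true⁺ : ∀ {x y} → x ≡ true → y ≡ true → x ∧ y ≡ true
∧≡true⁺ refl refl = refl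

≤ᵇ1⇒≤1 : ∀ {n} → (n ≤ᵇ 1) ≡ true → n ≤ 1
≤ᵇ1⇒≤1 {zero} _ = z≤n
≤ᵇ1⇒≤1 {suc zero} _ = s≤s z≤n

≤1⇒≤ᵇ1 : ∀ {n} → n ≤ 1 → (n ≤ᵇ 1) ≡ true
≤1⇒≤ᵇ1 z≤n = refl
≤1⇒≤ᵇ1 (s≤s z≤n) = refl

parity-conditions : ∀ a m₀ m₁ f₀ f₁ →
  ((a ≤ᵇ 1) ∧ (oddShuffles m₁ m₀ ∧ (isOdd f₁ ∧ isOdd f₀)) ≡ true) ⇔
  (a ≤ 1 × BinDisjoint a (2 * m₀) × BinDisjoint a (2 * m₁) × BinDisjoint (2 * m₀) (2 * m₁) × Odd f₀ × Odd f₁)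
parity-conditions a m₀ m₁ f₀ f₁ = mk⇔ to from
  where
  open Equivalence (oddShuffles⇔BinDisjoint m₁ m₀) renaming (to to disjoint; from to odd-shuffles)
  to : (a ≤ᵇ 1) ∧ (oddShuffles m₁ m₀ ∧ (isOdd f₁ ∧ isOdd f₀)) ≡ true →
       a ≤ 1 × BinDisjoint a (2 * m₀) × BinDisjoint a (2 * m₁) × BinDisjoint (2 * m₀) (2 * m₁) × Odd f₀ × Odd f₁
  to all-true with ∧≡true⁻ all-true
  ... | small , rest with ∧≡true⁻ rest
  ... | shuffles-odd , fs-odd with ∧≡true⁻ fs-odd
  ... | f₁-odd , f₀-odd = ≤ᵇ1⇒≤1 small , BinDisjoint-≤1 m₀ (≤ᵇ1⇒≤1 small) , BinDisjoint-≤1 m₁ (≤ᵇ1⇒≤1 small) ,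
                          BinDisjoint-double⁺ (BinDisjoint-sym (disjoint shuffles-odd)) , isOdd⇒Odd f₀ f₀-odd , isOdd⇒Odd f₁ f₁-odd
  from : a ≤ 1 × BinDisjoint a (2 * m₀) × BinDisjoint a (2 * m₁) × BinDisjoint (2 * m₀) (2 * m₁) × Odd f₀ × Odd f₁ →
         (a ≤ᵇ 1) ∧ (oddShuffles m₁ m₀ ∧ (isOdd f₁ ∧ isOdd f₀)) ≡ true
  from (a≤1 , _ , _ , disjoint₀₁ , f₀-odd , f₁-odd) =
    ∧≡true⁺ (≤1⇒≤ᵇ1 a≤1) (∧≡true⁺ (odd-shuffles (BinDisjoint-sym (BinDisjoint-double⁻ disjoint₀₁)))
                                   (∧≡true⁺ (Odd⇒isOdd f₁ f₁-odd) (Odd⇒isOdd f₀ f₀-odd)))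

lemma6p2 : (λ′ : List ℕ) → IsPartition λ′ →
    Odd (f λ′) ⇔
      ( size (core2 λ′) ≤ 1
      × BinDisjoint (size (core2 λ′)) (2 * size (quo0 λ′))
      × BinDisjoint (size (core2 λ′)) (2 * size (quo1 λ′))
      × BinDisjoint (2 * size (quo0 λ′)) (2 * size (quo1 λ′))
      × Odd (f (quo0 λ′))
      × Odd (f (quo1 λ′)) )
lemma6p2 λ′ partition =
  ⇔-trans (Odd⇔isOdd (f λ′))
  (⇔-trans (≡true-cong (oddSYT-quotient λ′ partition))
           (parity-conditions (size (core2 λ′)) (size (quo0 λ′)) (size (quo1 λ′)) (f (quo0 λ′)) (f (quo1 λ′))))
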